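{- Let $m,n$ be positive integers with $m\geq n$. Then \[ \sum_{k=0}^{n} \binom{m+k}{k} \binom{m}{k} \binom{n+k}{k} \binom{n}{k} \Bigl[ 1+k \bigl(H_{m+k}^{(1)} +H_{m-k}^{(1)} + H_{n+k}^{(1)} + H_{n-k}^{(1)} -4H_k^{(1)}\bigr) \Bigr] +\sum_{k=n+1}^{m} (-1)^{k-n} \binom{m+k}{k} \binom{m}{k} \binom{n+k}{k} \Big/ \binom{k-1}{n} =(-1)^{m+n}. \]
   Context: For non-negative integers $i$ and $N$, the generalized harmonic sum is $H^{(i)}_N:=\sum_{j=1}^{N} j^{ -i}$, with $H^{(i)}_0:=0$. The second sum is empty when $m=n$. -}

module Defs where

open import Data.Nat as ℕ using (ℕ; zero; suc; _∸_)
open import Data.Nat.Combinatorics using (_C_)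
open import Data.Integer as ℤ using (ℤ; +_)
open import Data.Rational using (ℚ; 0ℚ; 1ℚ; _+_; _*_; _-_; -_; _/_)

⟦_⟧ : ℕ → ℚ
⟦ n ⟧ = (+ n) / 1

-- reciprocal of a natural number; inv 0 = 0 (junk value, never used
-- in the theorem since all denominators there are ≥ 1)
inv : ℕ → ℚ
inv zero    = 0ℚ
inv (suc d) = (+ 1) / suc d

sign : ℕ → ℚ
sign zero    = 1ℚ
sign (suc k) = - sign k

H : ℕ → ℕ → ℚ
H i zero    = 0ℚ
H i (suc N) = H i N + inv (suc N ℕ.^ i)

-- Σ_{k=a}^{b} f k  (empty, i.e. 0, when b < a)
sumFromTo : ℕ → ℕ → (ℕ → ℚ) → ℚ
sumFromTo a b f = go (suc b ∸ a)
  where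
  go : ℕ → ℚ
  go zero    = 0ℚ
  go (suc j) = go j + f (a ℕ.+ j)

B : ℕ → ℕ → ℚ
B n k = ⟦ n C k ⟧

module Submission where

-- Let ρ_N(l) = (-1)^{N+l} C(N+l,l) C(N,l); these are the residues of
--   F_N(x) = (x+1)⋯(x+N) / (x(x-1)⋯(x-N)) = Σ_{l≤N} ρ_N(l)/(x-l).
-- With the convention 1/0 = 0 put G_N(j) = Σ_{l≤N} ρ_N(l)/(l-j) and K_N(j) = Σ_{l≤N} ρ_N(l)/(l-j)²;
-- thus G_N(j) = -F_N(j) away from the poles and -G_N(j) is the finite part of F_N at a pole j.
-- Induction on N along F_{N+1}(x) = F_N(x)·(x+N+1)/(x-N-1) establishes (record Invariant)
--   Σ_l ρ_N(l) = 1,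
--   j·C(j-1,N)·G_N(j) = -C(N+j,j)                             for j > N,
--   j·C(j-1,N)·K_N(j) = -C(N+j,j)·(H_{N+j} + H_{j-N-1} - 2H_j)  for j > N,
--   G_N(j) = -ρ_N(j)·(H_{N+j} + H_{N-j} - 2H_j)                for j ≤ N.
-- Independently, X_k = ρ_m(k)ρ_n(k) - k(ρ_m(k)G_n(k) + ρ_n(k)G_m(k)) sums to 1 over k ≤ m:
-- expand the G's as a double sum and symmetrise with k/(l-k) + l/(k-l) = [k = l] - 1.
-- Finally every summand of the theorem equals (-1)^{m+n}·X_k, by the last invariant for
-- k ≤ n and by the second one for n < k ≤ m (where ρ_n(k) = 0).

open import Defs
open import Data.Nat.Combinatorics
  using (_C_; nCk+nC[k+1]≡[n+1]C[k+1]; nC1≡n; nCn≡1; k>n⇒nCk≡0; nCk≡nC[n∸k])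
open import Data.Nat as ℕ using (ℕ; zero; suc; _≥_; _∸_)
import Data.Nat.Properties as ℕP
import Data.Nat.Solver as ℕSolver
open ℕSolver.+-*-Solver using ()
  renaming (solve to ℕsolve; _:+_ to _⊕_; _:*_ to _⊛_; _:=_ to _≔_; con to ℕcon)
import Data.Integer as ℤ
import Data.Integer.Properties as ℤP
import Data.Nat.Coprimality as Coprime
import Data.Sign.Base as Sign
open import Data.Rational using (ℚ; 0ℚ; 1ℚ; _+_; _*_; _-_; -_; mkℚ; 1/_; ↥_; toℚᵘ; ≢-nonZero)
open import Data.Rational.Properties
import Data.Rational.Unnormalised as ℚᵘ
import Data.Rational.Unnormalised.Properties as ℚᵘP
open import Data.Rational.Solver
open +-*-Solver using (solve; _:+_; _:*_; :-_; _:-_; con; _:=_)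
open import Relation.Binary.PropositionalEquality hiding (J)
open import Relation.Nullary using (yes; no; ¬_)
open import Relation.Nullary.Negation using (contradiction)

⟦⟧≡mkℚ : ∀ n → ⟦ n ⟧ ≡ mkℚ (ℤ.+ n) 0 (Coprime.sym (Coprime.1-coprimeTo n))
⟦⟧≡mkℚ n = ↥p/↧p≡p (mkℚ (ℤ.+ n) 0 _)

⟦⟧-+ : ∀ m n → ⟦ m ℕ.+ n ⟧ ≡ ⟦ m ⟧ + ⟦ n ⟧
⟦⟧-+ m n = toℚᵘ-injective (ℚᵘP.≃-trans unnormalised (ℚᵘP.≃-sym (toℚᵘ-homo-+ ⟦ m ⟧ ⟦ n ⟧)))
  where
  +n≡+◃n*1 : ∀ k → ℤ.+ k ≡ Sign.+ ℤ.◃ (k ℕ.* 1)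
  +n≡+◃n*1 k = sym (trans (ℤP.+◃n≡+n (k ℕ.* 1)) (cong ℤ.+_ (ℕP.*-identityʳ k)))
  unnormalised : toℚᵘ ⟦ m ℕ.+ n ⟧ ℚᵘ.≃ (toℚᵘ ⟦ m ⟧ ℚᵘ.+ toℚᵘ ⟦ n ⟧)
  unnormalised rewrite ⟦⟧≡mkℚ m | ⟦⟧≡mkℚ n | ⟦⟧≡mkℚ (m ℕ.+ n) =
    ℚᵘ.*≡* (cong (ℤ._* ℤ.+ 1) (trans (ℤP.pos-+ m n) (cong₂ ℤ._+_ (+n≡+◃n*1 m) (+n≡+◃n*1 n))))

⟦⟧-* : ∀ m n → ⟦ m ℕ.* n ⟧ ≡ ⟦ m ⟧ * ⟦ n ⟧
⟦⟧-* m n = toℚᵘ-injective (ℚᵘP.≃-trans unnormalised (ℚᵘP.≃-sym (toℚᵘ-homo-* ⟦ m ⟧ ⟦ n ⟧)))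
  where
  unnormalised : toℚᵘ ⟦ m ℕ.* n ⟧ ℚᵘ.≃ (toℚᵘ ⟦ m ⟧ ℚᵘ.* toℚᵘ ⟦ n ⟧)
  unnormalised rewrite ⟦⟧≡mkℚ m | ⟦⟧≡mkℚ n | ⟦⟧≡mkℚ (m ℕ.* n) =
    ℚᵘ.*≡* (cong (ℤ._* ℤ.+ 1) (ℤP.pos-* m n))

⟦⟧-injective : ∀ {m n} → ⟦ m ⟧ ≡ ⟦ n ⟧ → m ≡ n
⟦⟧-injective {m} {n} e with cong ↥_ (trans (sym (⟦⟧≡mkℚ m)) (trans e (⟦⟧≡mkℚ n)))
... | refl = refl

-- An opaque copy ι of ⟦_⟧: the ring solver must treat ι n as an atom, whereas ⟦ n ⟧
-- unfolds into a normalisation term.  All further arithmetic goes through ι.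
opaque
  ι : ℕ → ℚ
  ι n = ⟦ n ⟧

  ι-def : ∀ n → ι n ≡ ⟦ n ⟧
  ι-def n = refl

ι-+ : ∀ m n → ι (m ℕ.+ n) ≡ ι m + ι n
ι-+ m n = trans (ι-def (m ℕ.+ n)) (trans (⟦⟧-+ m n) (sym (cong₂ _+_ (ι-def m) (ι-def n))))

ι-* : ∀ m n → ι (m ℕ.* n) ≡ ι m * ι n
ι-* m n = trans (ι-def (m ℕ.* n)) (trans (⟦⟧-* m n) (sym (cong₂ _*_ (ι-def m) (ι-def n))))

ι-injective : ∀ {m n} → ι m ≡ ι n → m ≡ n
ι-injective {m} {n} e = ⟦⟧-injective (trans (sym (ι-def m)) (trans e (ι-def n)))

ι-0 : ι 0 ≡ 0ℚ
ι-0 = ι-def 0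

ι-1 : ι 1 ≡ 1ℚ
ι-1 = ι-def 1

ι-2 : ι 2 ≡ 1ℚ + 1ℚ
ι-2 = ι-def 2

ι-suc≢0 : ∀ n → ¬ (ι (suc n) ≡ 0ℚ)
ι-suc≢0 n e with ι-injective {suc n} {0} (trans e (sym ι-0))
... | ()

ι-suc+≢0 : ∀ N j → ¬ (ι (suc N) + ι j ≡ 0ℚ)
ι-suc+≢0 N j e = ι-suc≢0 (N ℕ.+ j) (trans (ι-+ (suc N) j) e)

+⇒≡- : ∀ x y z → x + y ≡ z → x ≡ z - y
+⇒≡- x y z e = trans (solve 2 (λ x y → x := (x :+ y) :- y) refl x y) (cong (_- y) e)

ι-∸ : ∀ m n → n ℕ.≤ m → ι (m ∸ n) ≡ ι m - ι n
ι-∸ m n n≤m = +⇒≡- (ι (m ∸ n)) (ι n) (ι m) (trans (sym (ι-+ (m ∸ n) n)) (cong ι (ℕP.m∸n+n≡m n≤m)))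

Cℚ : ℕ → ℕ → ℚ
Cℚ n k = ι (n C k)

-- The total reciprocal: recip p = 1/p for p ≠ 0 and recip 0 = 0.  It lets the sums G, K below
-- simply skip the singular term l = j, as the finite part of a partial-fraction sum requires.
opaque
  recip : ℚ → ℚ
  recip p with p ≟ 0ℚ
  ... | yes _ = 0ℚ
  ... | no p≢0 = (1/ p) {{≢-nonZero p≢0}}

  recip-0 : recip 0ℚ ≡ 0ℚ
  recip-0 = refl

  recip-inverse : ∀ p → ¬ (p ≡ 0ℚ) → p * recip p ≡ 1ℚ
  recip-inverse p p≢0 with p ≟ 0ℚ
  ... | yes p≡0 = contradiction p≡0 p≢0
  ... | no p≢0′ = *-inverseʳ p {{≢-nonZero p≢0′}}

recip-unique : ∀ p x → p * x ≡ 1ℚ → recip p ≡ x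
recip-unique p x px≡1 = begin
    recip p            ≡⟨ sym (*-identityʳ (recip p)) ⟩
    recip p * 1ℚ       ≡⟨ cong (recip p *_) (sym px≡1) ⟩
    recip p * (p * x)  ≡⟨ sym (*-assoc (recip p) p x) ⟩
    (recip p * p) * x  ≡⟨ cong (_* x) (trans (*-comm (recip p) p) (recip-inverse p p≢0)) ⟩
    1ℚ * x             ≡⟨ *-identityˡ x ⟩
    x                  ∎
  where
  open ≡-Reasoning
  p≢0 : ¬ (p ≡ 0ℚ)
  p≢0 refl = 1≢0 (trans (sym px≡1) (*-zeroˡ x))

recip-neg : ∀ p → recip (- p) ≡ - recip p
recip-neg p with p ≟ 0ℚ
... | yes refl = trans recip-0 (sym (cong -_ recip-0))
... | no p≢0 = recip-unique (- p) (- recip p)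
  (trans (solve 2 (λ a b → (:- a) :* (:- b) := a :* b) refl p (recip p)) (recip-inverse p p≢0))

*-cancelʳ-≢0 : ∀ x y c → ¬ (c ≡ 0ℚ) → x * c ≡ y * c → x ≡ y
*-cancelʳ-≢0 x y c c≢0 xc≡yc = begin
    x                ≡⟨ sym (trans (cong (x *_) (recip-inverse c c≢0)) (*-identityʳ x)) ⟩
    x * (c * recip c) ≡⟨ sym (*-assoc x c (recip c)) ⟩
    x * c * recip c   ≡⟨ cong (_* recip c) xc≡yc ⟩
    y * c * recip c   ≡⟨ *-assoc y c (recip c) ⟩
    y * (c * recip c) ≡⟨ trans (cong (y *_) (recip-inverse c c≢0)) (*-identityʳ y) ⟩
    y                 ∎
  where open ≡-Reasoning

inv≡recip : ∀ c → 0 ℕ.< c → inv c ≡ recip (ι c)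
inv≡recip (suc d) _ = sym (recip-unique (ι (suc d)) (inv (suc d)) (trans (cong (_* inv (suc d)) (ι-def (suc d))) product))
  where
  inv≡mkℚ : inv (suc d) ≡ mkℚ (ℤ.+ 1) d (Coprime.1-coprimeTo (suc d))
  inv≡mkℚ = ↥p/↧p≡p (mkℚ (ℤ.+ 1) d _)
  product : ⟦ suc d ⟧ * inv (suc d) ≡ 1ℚ
  product = toℚᵘ-injective (ℚᵘP.≃-trans (toℚᵘ-homo-* ⟦ suc d ⟧ (inv (suc d))) unnormalised)
    where
    unnormalised : (toℚᵘ ⟦ suc d ⟧ ℚᵘ.* toℚᵘ (inv (suc d))) ℚᵘ.≃ toℚᵘ 1ℚ
    unnormalised rewrite ⟦⟧≡mkℚ (suc d) | inv≡mkℚ = ℚᵘ.*≡* (cong (λ x → ℤ.+ suc x)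
      (trans (ℕP.*-identityʳ (d ℕ.* 1)) (trans (ℕP.*-identityʳ d)
        (sym (trans (ℕP.+-identityʳ (d ℕ.+ 0)) (ℕP.+-identityʳ d))))))

ι-recip-inverse : ∀ c → 0 ℕ.< c → ι c * recip (ι c) ≡ 1ℚ
ι-recip-inverse (suc d) _ = recip-inverse (ι (suc d)) (ι-suc≢0 d)

Σ< : ℕ → (ℕ → ℚ) → ℚ
Σ< zero    f = 0ℚ
Σ< (suc N) f = Σ< N f + f N

Σfrom : ℕ → ℕ → (ℕ → ℚ) → ℚ
Σfrom a zero    f = 0ℚ
Σfrom a (suc k) f = Σfrom a k f + f (a ℕ.+ k)

sumFromTo-0≡Σ< : ∀ b f → sumFromTo 0 b f ≡ Σ< (suc b) f
sumFromTo-0≡Σ< zero    f = refl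
sumFromTo-0≡Σ< (suc b) f = cong (_+ f (suc b)) (sumFromTo-0≡Σ< b f)

suc[a+k]∸a≡suc[k] : ∀ a k → suc (a ℕ.+ k) ∸ a ≡ suc k
suc[a+k]∸a≡suc[k] zero    k = refl
suc[a+k]∸a≡suc[k] (suc a) k = suc[a+k]∸a≡suc[k] a k

sumFromTo≡Σfrom : ∀ a b f k → suc b ∸ a ≡ k → sumFromTo a b f ≡ Σfrom a k f
sumFromTo≡Σfrom a b f k eq rewrite eq with k
... | zero = refl
... | suc zero = refl
... | suc (suc k′) with sumFromTo≡Σfrom a (a ℕ.+ k′) f (suc k′) (suc[a+k]∸a≡suc[k] a k′)
... | shorter with suc (a ℕ.+ k′) ∸ a | suc[a+k]∸a≡suc[k] a k′
... | .(suc k′) | refl = cong (_+ f (a ℕ.+ suc k′)) shorter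

Σ<-split : ∀ a k f → Σ< (a ℕ.+ k) f ≡ Σ< a f + Σfrom a k f
Σ<-split a zero    f rewrite ℕP.+-identityʳ a = sym (+-identityʳ (Σ< a f))
Σ<-split a (suc k) f rewrite ℕP.+-suc a k = begin
    Σ< (a ℕ.+ k) f + f (a ℕ.+ k)        ≡⟨ cong (_+ f (a ℕ.+ k)) (Σ<-split a k f) ⟩
    Σ< a f + Σfrom a k f + f (a ℕ.+ k)  ≡⟨ +-assoc (Σ< a f) (Σfrom a k f) (f (a ℕ.+ k)) ⟩
    Σ< a f + (Σfrom a k f + f (a ℕ.+ k)) ∎
  where open ≡-Reasoning

Σ<-cong : ∀ N {f g : ℕ → ℚ} → (∀ l → l ℕ.< N → f l ≡ g l) → Σ< N f ≡ Σ< N g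
Σ<-cong zero    f≗g = refl
Σ<-cong (suc N) f≗g = cong₂ _+_ (Σ<-cong N (λ l l<N → f≗g l (ℕP.m<n⇒m<1+n l<N))) (f≗g N (ℕP.n<1+n N))

Σfrom-cong : ∀ a k {f g : ℕ → ℚ} → (∀ j → j ℕ.< k → f (a ℕ.+ j) ≡ g (a ℕ.+ j)) → Σfrom a k f ≡ Σfrom a k g
Σfrom-cong a zero    f≗g = refl
Σfrom-cong a (suc k) f≗g = cong₂ _+_ (Σfrom-cong a k (λ j j<k → f≗g j (ℕP.m<n⇒m<1+n j<k))) (f≗g k (ℕP.n<1+n k))

Σ<-zero : ∀ N → Σ< N (λ _ → 0ℚ) ≡ 0ℚ
Σ<-zero zero    = refl
Σ<-zero (suc N) rewrite Σ<-zero N = refl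

Σ<-+ : ∀ N (f g : ℕ → ℚ) → Σ< N (λ l → f l + g l) ≡ Σ< N f + Σ< N g
Σ<-+ zero    f g = refl
Σ<-+ (suc N) f g rewrite Σ<-+ N f g =
  solve 4 (λ a b c d → a :+ b :+ (c :+ d) := a :+ c :+ (b :+ d)) refl (Σ< N f) (Σ< N g) (f N) (g N)

Σ<-*ˡ : ∀ N c (f : ℕ → ℚ) → Σ< N (λ l → c * f l) ≡ c * Σ< N f
Σ<-*ˡ zero    c f = sym (*-zeroʳ c)
Σ<-*ˡ (suc N) c f rewrite Σ<-*ˡ N c f = sym (*-distribˡ-+ c (Σ< N f) (f N))

Σ<-neg : ∀ N (f : ℕ → ℚ) → Σ< N (λ l → - f l) ≡ - Σ< N f
Σ<-neg zero    f = refl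
Σ<-neg (suc N) f rewrite Σ<-neg N f = sym (neg-distrib-+ (Σ< N f) (f N))

Σ<-sub : ∀ N (f g : ℕ → ℚ) → Σ< N (λ l → f l - g l) ≡ Σ< N f - Σ< N g
Σ<-sub N f g = trans (Σ<-+ N f (λ l → - g l)) (cong (Σ< N f +_) (Σ<-neg N g))

Σ<-linear₂ : ∀ N c₁ c₂ (f₁ f₂ : ℕ → ℚ) →
  Σ< N (λ l → c₁ * f₁ l + c₂ * f₂ l) ≡ c₁ * Σ< N f₁ + c₂ * Σ< N f₂
Σ<-linear₂ N c₁ c₂ f₁ f₂ =
  trans (Σ<-+ N (λ l → c₁ * f₁ l) (λ l → c₂ * f₂ l)) (cong₂ _+_ (Σ<-*ˡ N c₁ f₁) (Σ<-*ˡ N c₂ f₂))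

Σ<-linear₃ : ∀ N c₁ c₂ c₃ (f₁ f₂ f₃ : ℕ → ℚ) →
  Σ< N (λ l → c₁ * f₁ l + c₂ * f₂ l + c₃ * f₃ l) ≡ c₁ * Σ< N f₁ + c₂ * Σ< N f₂ + c₃ * Σ< N f₃
Σ<-linear₃ N c₁ c₂ c₃ f₁ f₂ f₃ =
  trans (Σ<-+ N (λ l → c₁ * f₁ l + c₂ * f₂ l) (λ l → c₃ * f₃ l)) (cong₂ _+_ (Σ<-linear₂ N c₁ c₂ f₁ f₂) (Σ<-*ˡ N c₃ f₃))

Σ<-vanishing-tail : ∀ n k (f : ℕ → ℚ) → (∀ l → n ℕ.≤ l → f l ≡ 0ℚ) → Σ< (n ℕ.+ k) f ≡ Σ< n f
Σ<-vanishing-tail n zero    f vanish rewrite ℕP.+-identityʳ n = refl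
Σ<-vanishing-tail n (suc k) f vanish
  rewrite ℕP.+-suc n k | Σ<-vanishing-tail n k f vanish | vanish (n ℕ.+ k) (ℕP.m≤m+n n k) = +-identityʳ (Σ< n f)

Σ<-swap : ∀ N M (F : ℕ → ℕ → ℚ) → Σ< N (λ k → Σ< M (λ l → F k l)) ≡ Σ< M (λ l → Σ< N (λ k → F k l))
Σ<-swap zero    M F = sym (Σ<-zero M)
Σ<-swap (suc N) M F rewrite Σ<-swap N M F = sym (Σ<-+ M (λ l → Σ< N (λ k → F k l)) (λ l → F N l))

δ : ℕ → ℕ → ℚ
δ l j with l ℕ.≟ j
... | yes _ = 1ℚ
... | no  _ = 0ℚ

δ-≢ : ∀ l j → ¬ (l ≡ j) → δ l j ≡ 0ℚ
δ-≢ l j l≢j with l ℕ.≟ j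
... | yes l≡j = contradiction l≡j l≢j
... | no  _   = refl

δ-refl : ∀ l → δ l l ≡ 1ℚ
δ-refl l with l ℕ.≟ l
... | yes _   = refl
... | no  l≢l = contradiction refl l≢l

Σ<-δ : ∀ N (f : ℕ → ℚ) k → k ℕ.< N → Σ< N (λ l → f l * δ l k) ≡ f k
Σ<-δ (suc N) f k k<1+N with k ℕ.≟ N
... | yes refl = begin
    Σ< k (λ l → f l * δ l k) + f k * δ k k
      ≡⟨ cong₂ _+_ (trans (Σ<-cong k (λ l l<k → trans (cong (f l *_) (δ-≢ l k (ℕP.<⇒≢ l<k))) (*-zeroʳ (f l))))
                          (Σ<-zero k))
                   (cong (f k *_) (δ-refl k)) ⟩
    0ℚ + f k * 1ℚ
      ≡⟨ trans (+-identityˡ _) (*-identityʳ (f k)) ⟩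
    f k ∎
  where open ≡-Reasoning
... | no k≢N = begin
    Σ< N (λ l → f l * δ l k) + f N * δ N k
      ≡⟨ cong₂ _+_ (Σ<-δ N f k (ℕP.≤∧≢⇒< (ℕP.≤-pred k<1+N) k≢N))
                   (trans (cong (f N *_) (δ-≢ N k (λ N≡k → k≢N (sym N≡k)))) (*-zeroʳ (f N))) ⟩
    f k + 0ℚ
      ≡⟨ +-identityʳ (f k) ⟩
    f k ∎
  where open ≡-Reasoning

pascal : ∀ n k → n C k ℕ.+ n C (suc k) ≡ suc n C suc k
pascal = nCk+nC[k+1]≡[n+1]C[k+1]

absorption : ∀ n k → suc k ℕ.* (suc n C suc k) ≡ suc n ℕ.* (n C k)
absorption zero    zero    = refl
absorption zero    (suc k) = ℕP.*-zeroʳ (suc (suc k))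
absorption (suc n) zero    =
  trans (ℕP.+-identityʳ (suc (suc n) C 1)) (trans (nC1≡n (suc (suc n))) (sym (ℕP.*-identityʳ (suc (suc n)))))
absorption (suc n) (suc k) = begin
    suc (suc k) ℕ.* (suc (suc n) C suc (suc k))
      ≡⟨ cong (suc (suc k) ℕ.*_) (sym (pascal (suc n) (suc k))) ⟩
    suc (suc k) ℕ.* (X ℕ.+ Y)
      ≡⟨ ℕsolve 3 (λ k x y → (ℕcon 2 ⊕ k) ⊛ (x ⊕ y) ≔ x ⊕ ((ℕcon 1 ⊕ k) ⊛ x ⊕ (ℕcon 2 ⊕ k) ⊛ y)) refl k X Y ⟩
    X ℕ.+ (suc k ℕ.* X ℕ.+ suc (suc k) ℕ.* Y)
      ≡⟨ cong (X ℕ.+_) (cong₂ ℕ._+_ (absorption n k) (absorption n (suc k))) ⟩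
    X ℕ.+ (suc n ℕ.* (n C k) ℕ.+ suc n ℕ.* (n C suc k))
      ≡⟨ cong (X ℕ.+_) (trans (sym (ℕP.*-distribˡ-+ (suc n) (n C k) (n C suc k))) (cong (suc n ℕ.*_) (pascal n k))) ⟩
    suc (suc n) ℕ.* X ∎
  where
  open ≡-Reasoning
  X = suc n C suc k
  Y = suc n C suc (suc k)

absorption-sum : ∀ n k → suc k ℕ.* (n C suc k) ℕ.+ k ℕ.* (n C k) ≡ n ℕ.* (n C k)
absorption-sum zero    zero    = refl
absorption-sum zero    (suc k) = cong₂ ℕ._+_ (ℕP.*-zeroʳ (suc (suc k))) (ℕP.*-zeroʳ (suc k))
absorption-sum (suc n) zero    = trans (ℕP.+-identityʳ _) (absorption n 0)
absorption-sum (suc n) (suc k) = begin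
    suc (suc k) ℕ.* (suc n C suc (suc k)) ℕ.+ suc k ℕ.* (suc n C suc k)
      ≡⟨ cong₂ ℕ._+_ (absorption n (suc k)) (absorption n k) ⟩
    suc n ℕ.* (n C suc k) ℕ.+ suc n ℕ.* (n C k)
      ≡⟨ sym (ℕP.*-distribˡ-+ (suc n) (n C suc k) (n C k)) ⟩
    suc n ℕ.* (n C suc k ℕ.+ n C k)
      ≡⟨ cong (suc n ℕ.*_) (trans (ℕP.+-comm (n C suc k) (n C k)) (pascal n k)) ⟩
    suc n ℕ.* (suc n C suc k) ∎
  where open ≡-Reasoning

absorption-lower : ∀ N l → (suc N C l) ℕ.* suc N ≡ l ℕ.* (suc N C l) ℕ.+ suc N ℕ.* (N C l)
absorption-lower N zero    = trans (ℕP.+-identityʳ (suc N)) (sym (ℕP.*-identityʳ (suc N)))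
absorption-lower N (suc l) = begin
    (suc N C suc l) ℕ.* suc N
      ≡⟨ ℕP.*-comm (suc N C suc l) (suc N) ⟩
    suc N ℕ.* (suc N C suc l)
      ≡⟨ cong (suc N ℕ.*_) (sym (pascal N l)) ⟩
    suc N ℕ.* ((N C l) ℕ.+ (N C suc l))
      ≡⟨ ℕP.*-distribˡ-+ (suc N) (N C l) (N C suc l) ⟩
    suc N ℕ.* (N C l) ℕ.+ suc N ℕ.* (N C suc l)
      ≡⟨ cong (ℕ._+ (suc N ℕ.* (N C suc l))) (sym (absorption N l)) ⟩
    suc l ℕ.* (suc N C suc l) ℕ.+ suc N ℕ.* (N C suc l) ∎
  where open ≡-Reasoning

-- C(N+1+l,l)·(N+1) = (N+1+l)·C(N+l,l), i.e. absorption applied to the complementary index.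
absorption-upper : ∀ N l → ((suc N ℕ.+ l) C l) ℕ.* suc N ≡ (suc N ℕ.+ l) ℕ.* ((N ℕ.+ l) C l)
absorption-upper N l = begin
    ((suc N ℕ.+ l) C l) ℕ.* suc N
      ≡⟨ cong (ℕ._* suc N) (complement (suc N)) ⟩
    (suc (N ℕ.+ l) C suc N) ℕ.* suc N
      ≡⟨ ℕP.*-comm (suc (N ℕ.+ l) C suc N) (suc N) ⟩
    suc N ℕ.* (suc (N ℕ.+ l) C suc N)
      ≡⟨ absorption (N ℕ.+ l) N ⟩
    suc (N ℕ.+ l) ℕ.* ((N ℕ.+ l) C N)
      ≡⟨ cong (suc (N ℕ.+ l) ℕ.*_) (sym (complement N)) ⟩
    (suc N ℕ.+ l) ℕ.* ((N ℕ.+ l) C l) ∎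
  where
  open ≡-Reasoning
  complement : ∀ M → ((M ℕ.+ l) C l) ≡ ((M ℕ.+ l) C M)
  complement M = trans (nCk≡nC[n∸k] (ℕP.m≤n+m l M)) (cong ((M ℕ.+ l) C_) (ℕP.m+n∸n≡m M l))

C-positive : ∀ n k → k ℕ.≤ n → 0 ℕ.< n C k
C-positive n       zero    _            = ℕ.s≤s ℕ.z≤n
C-positive (suc n) (suc k) (ℕ.s≤s k≤n) =
  subst (0 ℕ.<_) (pascal n k) (ℕP.<-≤-trans (C-positive n k k≤n) (ℕP.m≤m+n _ _))

central-C-double : ∀ N → ((suc N ℕ.+ suc N) C suc N) ≡ 2 ℕ.* ((suc N ℕ.+ N) C suc N)
central-C-double N = begin
    ((suc N ℕ.+ suc N) C suc N)
      ≡⟨ cong (λ t → suc t C suc N) (ℕP.+-suc N N) ⟩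
    (suc (suc (N ℕ.+ N)) C suc N)
      ≡⟨ sym (pascal (suc (N ℕ.+ N)) N) ⟩
    (suc (N ℕ.+ N) C N) ℕ.+ (suc (N ℕ.+ N) C suc N)
      ≡⟨ cong (ℕ._+ (suc (N ℕ.+ N) C suc N)) symmetric ⟩
    (suc (N ℕ.+ N) C suc N) ℕ.+ (suc (N ℕ.+ N) C suc N)
      ≡⟨ cong ((suc (N ℕ.+ N) C suc N) ℕ.+_) (sym (ℕP.+-identityʳ (suc (N ℕ.+ N) C suc N))) ⟩
    2 ℕ.* ((suc N ℕ.+ N) C suc N) ∎
  where
  open ≡-Reasoning
  symmetric : suc (N ℕ.+ N) C N ≡ suc (N ℕ.+ N) C suc N
  symmetric = trans (nCk≡nC[n∸k] (ℕP.≤-trans (ℕP.m≤m+n N N) (ℕP.n≤1+n _)))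
                    (cong (suc (N ℕ.+ N) C_) (trans (ℕP.+-∸-assoc 1 (ℕP.m≤n+m N N)) (cong suc (ℕP.m+n∸n≡m N N))))

sign-+ : ∀ a b → sign (a ℕ.+ b) ≡ sign a * sign b
sign-+ zero    b = sym (*-identityˡ (sign b))
sign-+ (suc a) b = trans (cong -_ (sign-+ a b)) (neg-distribˡ-* (sign a) (sign b))

sign-square : ∀ a → sign a * sign a ≡ 1ℚ
sign-square zero    = refl
sign-square (suc a) = trans (solve 1 (λ s → (:- s) :* (:- s) := s :* s) refl (sign a)) (sign-square a)

sign-double : ∀ a → sign (a ℕ.+ a) ≡ 1ℚ
sign-double a = trans (sign-+ a a) (sign-square a)

sign-cancel : ∀ m n k → sign (m ℕ.+ n) * (sign (m ℕ.+ k) * sign (n ℕ.+ k)) ≡ 1ℚ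
sign-cancel m n k = begin
    sign (m ℕ.+ n) * (sign (m ℕ.+ k) * sign (n ℕ.+ k))
      ≡⟨ cong₂ _*_ (sign-+ m n) (cong₂ _*_ (sign-+ m k) (sign-+ n k)) ⟩
    sign m * sign n * (sign m * sign k * (sign n * sign k))
      ≡⟨ solve 3 (λ a b c → a :* b :* (a :* c :* (b :* c)) := (a :* a) :* (b :* b) :* (c :* c)) refl (sign m) (sign n) (sign k) ⟩
    (sign m * sign m) * (sign n * sign n) * (sign k * sign k)
      ≡⟨ cong₂ (λ x y → x * y * (sign k * sign k)) (sign-square m) (sign-square n) ⟩
    1ℚ * 1ℚ * (sign k * sign k)
      ≡⟨ cong (1ℚ * 1ℚ *_) (sign-square k) ⟩
    1ℚ ∎
  where open ≡-Reasoning

sign-shift : ∀ m n k → n ℕ.≤ k → sign (m ℕ.+ n) * sign (m ℕ.+ k) ≡ sign (k ∸ n)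
sign-shift m n k n≤k = begin
    sign (m ℕ.+ n) * sign (m ℕ.+ k)
      ≡⟨ cong₂ _*_ (sign-+ m n) (trans (cong (λ t → sign (m ℕ.+ t)) (sym (ℕP.m+[n∸m]≡n n≤k)))
                                      (trans (sign-+ m (n ℕ.+ (k ∸ n))) (cong (sign m *_) (sign-+ n (k ∸ n))))) ⟩
    sign m * sign n * (sign m * (sign n * sign (k ∸ n)))
      ≡⟨ solve 3 (λ a b c → a :* b :* (a :* (b :* c)) := (a :* a) :* (b :* b) :* c) refl (sign m) (sign n) (sign (k ∸ n)) ⟩
    (sign m * sign m) * (sign n * sign n) * sign (k ∸ n)
      ≡⟨ cong₂ (λ x y → x * y * sign (k ∸ n)) (sign-square m) (sign-square n) ⟩
    1ℚ * 1ℚ * sign (k ∸ n)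
      ≡⟨ solve 1 (λ x → con 1ℚ :* con 1ℚ :* x := x) refl (sign (k ∸ n)) ⟩
    sign (k ∸ n) ∎
  where open ≡-Reasoning

gap : ℕ → ℕ → ℚ
gap l j = ι l - ι j

gap-self : ∀ j → gap j j ≡ 0ℚ
gap-self j = +-inverseʳ (ι j)

gap≢0 : ∀ l j → ¬ (l ≡ j) → ¬ (gap l j ≡ 0ℚ)
gap≢0 l j l≢j gap≡0 = l≢j (ι-injective (begin
    ι l            ≡⟨ solve 2 (λ x y → x := (x :- y) :+ y) refl (ι l) (ι j) ⟩
    gap l j + ι j  ≡⟨ cong (_+ ι j) gap≡0 ⟩
    0ℚ + ι j       ≡⟨ +-identityˡ (ι j) ⟩
    ι j            ∎))
  where open ≡-Reasoning

gap-inverse : ∀ l j → ¬ (l ≡ j) → gap l j * recip (gap l j) ≡ 1ℚ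
gap-inverse l j l≢j = recip-inverse (gap l j) (gap≢0 l j l≢j)

recip-gap-swap : ∀ l j → recip (gap l j) ≡ - recip (gap j l)
recip-gap-swap l j =
  trans (cong recip (solve 2 (λ x y → x :- y := :- (y :- x)) refl (ι l) (ι j))) (recip-neg (gap j l))

-- Two partial-fraction decompositions in the variable L, valid whenever
-- r₁ = 1/(L-J), r₂ = 1/(A-L), r₃ = 1/(A-J):
--   (A+L)/((A-L)(L-J))  = (A+J)/((A-J)(L-J)) + 2A/((A-J)(A-L)),
--   (A+L)/((A-L)(L-J)²) = 2A/((A-J)²(A-L)) + (A+J)/((A-J)(L-J)²) + 2A/((A-J)²(L-J)).
-- They drive the passage from F_N to F_{N+1} = F_N·(x+A)/(x-A) with A = N+1.

partial-fractions₁ : ∀ A L J r₁ r₂ r₃ → (L - J) * r₁ ≡ 1ℚ → (A - L) * r₂ ≡ 1ℚ → (A - J) * r₃ ≡ 1ℚ →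
  (A + L) * r₂ * r₁ ≡ (A + J) * r₃ * r₁ + (A + A) * r₃ * r₂
partial-fractions₁ A L J r₁ r₂ r₃ inv₁ inv₂ inv₃ = begin
    (A + L) * r₂ * r₁
      ≡⟨ sym (trans (cong ((A + L) * r₂ * r₁ *_) inv₃) (*-identityʳ ((A + L) * r₂ * r₁))) ⟩
    (A + L) * r₂ * r₁ * ((A - J) * r₃)
      ≡⟨ solve 6 (λ A L J r₁ r₂ r₃ → (A :+ L) :* r₂ :* r₁ :* ((A :- J) :* r₃) :=
             (A :+ J) :* r₃ :* r₁ :* ((A :- L) :* r₂) :+ (A :+ A) :* r₃ :* r₂ :* ((L :- J) :* r₁)) refl A L J r₁ r₂ r₃ ⟩
    (A + J) * r₃ * r₁ * ((A - L) * r₂) + (A + A) * r₃ * r₂ * ((L - J) * r₁)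
      ≡⟨ cong₂ _+_ (trans (cong ((A + J) * r₃ * r₁ *_) inv₂) (*-identityʳ ((A + J) * r₃ * r₁)))
                   (trans (cong ((A + A) * r₃ * r₂ *_) inv₁) (*-identityʳ ((A + A) * r₃ * r₂))) ⟩
    (A + J) * r₃ * r₁ + (A + A) * r₃ * r₂ ∎
  where open ≡-Reasoning

partial-fractions₂ : ∀ A L J r₁ r₂ r₃ → (L - J) * r₁ ≡ 1ℚ → (A - L) * r₂ ≡ 1ℚ → (A - J) * r₃ ≡ 1ℚ →
  (A + L) * r₂ * (r₁ * r₁) ≡ (A + A) * (r₃ * r₃) * r₂ + (A + J) * r₃ * (r₁ * r₁) + (A + A) * (r₃ * r₃) * r₁
partial-fractions₂ A L J r₁ r₂ r₃ inv₁ inv₂ inv₃ = begin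
    (A + L) * r₂ * (r₁ * r₁)
      ≡⟨ sym (trans (cong (λ t → (A + L) * r₂ * (r₁ * r₁) * t * t) inv₃)
                    (solve 3 (λ x y z → x :* y :* (z :* z) :* con 1ℚ :* con 1ℚ := x :* y :* (z :* z)) refl (A + L) r₂ r₁)) ⟩
    (A + L) * r₂ * (r₁ * r₁) * ((A - J) * r₃) * ((A - J) * r₃)
      ≡⟨ solve 6 (λ A L J r₁ r₂ r₃ → (A :+ L) :* r₂ :* (r₁ :* r₁) :* ((A :- J) :* r₃) :* ((A :- J) :* r₃) :=
             (A :+ A) :* (r₃ :* r₃) :* r₂ :* (((L :- J) :* r₁) :* ((L :- J) :* r₁))
             :+ (A :+ J) :* r₃ :* (r₁ :* r₁) :* (((A :- J) :* r₃) :* ((A :- L) :* r₂))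
             :+ (A :+ A) :* (r₃ :* r₃) :* r₁ :* (((L :- J) :* r₁) :* ((A :- L) :* r₂))) refl A L J r₁ r₂ r₃ ⟩
    (A + A) * (r₃ * r₃) * r₂ * (((L - J) * r₁) * ((L - J) * r₁))
      + (A + J) * r₃ * (r₁ * r₁) * (((A - J) * r₃) * ((A - L) * r₂))
      + (A + A) * (r₃ * r₃) * r₁ * (((L - J) * r₁) * ((A - L) * r₂))
      ≡⟨ cong₂ _+_ (cong₂ _+_ (cong ((A + A) * (r₃ * r₃) * r₂ *_) (cong₂ _*_ inv₁ inv₁))
                              (cong ((A + J) * r₃ * (r₁ * r₁) *_) (cong₂ _*_ inv₃ inv₂)))
                   (cong ((A + A) * (r₃ * r₃) * r₁ *_) (cong₂ _*_ inv₁ inv₂)) ⟩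
    (A + A) * (r₃ * r₃) * r₂ * (1ℚ * 1ℚ) + (A + J) * r₃ * (r₁ * r₁) * (1ℚ * 1ℚ) + (A + A) * (r₃ * r₃) * r₁ * (1ℚ * 1ℚ)
      ≡⟨ solve 3 (λ x y z → x :* (con 1ℚ :* con 1ℚ) :+ y :* (con 1ℚ :* con 1ℚ) :+ z :* (con 1ℚ :* con 1ℚ) := x :+ y :+ z)
           refl ((A + A) * (r₃ * r₃) * r₂) ((A + J) * r₃ * (r₁ * r₁)) ((A + A) * (r₃ * r₃) * r₁) ⟩
    (A + A) * (r₃ * r₃) * r₂ + (A + J) * r₃ * (r₁ * r₁) + (A + A) * (r₃ * r₃) * r₁ ∎
  where open ≡-Reasoning

Cℚ-diagonal : ∀ N → Cℚ N N ≡ 1ℚ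
Cℚ-diagonal N = trans (cong ι (nCn≡1 N)) ι-1

Cℚ-absorption-lower : ∀ N l → Cℚ (suc N) l * ι (suc N) ≡ ι l * Cℚ (suc N) l + ι (suc N) * Cℚ N l
Cℚ-absorption-lower N l = trans (sym (ι-* (suc N C l) (suc N))) (trans (cong ι (absorption-lower N l))
  (trans (ι-+ (l ℕ.* (suc N C l)) (suc N ℕ.* (N C l))) (cong₂ _+_ (ι-* l (suc N C l)) (ι-* (suc N) (N C l)))))

Cℚ-absorption-upper : ∀ N l → Cℚ (suc N ℕ.+ l) l * ι (suc N) ≡ (ι (suc N) + ι l) * Cℚ (N ℕ.+ l) l
Cℚ-absorption-upper N l = trans (sym (ι-* ((suc N ℕ.+ l) C l) (suc N))) (trans (cong ι (absorption-upper N l))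
  (trans (ι-* (suc N ℕ.+ l) ((N ℕ.+ l) C l)) (cong (_* Cℚ (N ℕ.+ l) l) (ι-+ (suc N) l))))

Cℚ-absorption-sum : ∀ N j → suc N ℕ.< j → ι (suc N) * Cℚ (j ∸ 1) (suc N) ≡ (ι j - ι (suc N)) * Cℚ (j ∸ 1) N
Cℚ-absorption-sum N j a<j = begin
    A * C⁺
      ≡⟨ +⇒≡- (A * C⁺) (ι N * C₀) (ι (j ∸ 1) * C₀)
           (trans (cong₂ _+_ (sym (ι-* (suc N) ((j ∸ 1) C suc N))) (sym (ι-* N ((j ∸ 1) C N))))
           (trans (sym (ι-+ (suc N ℕ.* ((j ∸ 1) C suc N)) (N ℕ.* ((j ∸ 1) C N))))
           (trans (cong ι (absorption-sum (j ∸ 1) N)) (ι-* (j ∸ 1) ((j ∸ 1) C N))))) ⟩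
    ι (j ∸ 1) * C₀ - ι N * C₀
      ≡⟨ cong (λ x → x * C₀ - ι N * C₀) (ι-∸ j 1 (ℕP.≤-trans (ℕ.s≤s ℕ.z≤n) a<j)) ⟩
    (ι j - ι 1) * C₀ - ι N * C₀
      ≡⟨ solve 4 (λ J o n c → (J :- o) :* c :- n :* c := (J :- (o :+ n)) :* c) refl (ι j) (ι 1) (ι N) C₀ ⟩
    (ι j - (ι 1 + ι N)) * C₀
      ≡⟨ cong (λ x → (ι j - x) * C₀) (sym (ι-+ 1 N)) ⟩
    (ι j - A) * C₀ ∎
  where
  open ≡-Reasoning
  A = ι (suc N)
  C⁺ = Cℚ (j ∸ 1) (suc N)
  C₀ = Cℚ (j ∸ 1) N

Cℚ-central : ∀ N → Cℚ (suc N ℕ.+ suc N) (suc N) ≡ (1ℚ + 1ℚ) * Cℚ (N ℕ.+ suc N) (suc N)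
Cℚ-central N = trans (cong ι (central-C-double N)) (trans (ι-* 2 ((suc N ℕ.+ N) C suc N))
  (cong₂ _*_ ι-2 (cong (λ t → ι (t C suc N)) (sym (ℕP.+-suc N N)))))

ρ : ℕ → ℕ → ℚ
ρ N l = sign (N ℕ.+ l) * Cℚ (N ℕ.+ l) l * Cℚ N l

ρ-vanishes : ∀ N l → N ℕ.< l → ρ N l ≡ 0ℚ
ρ-vanishes N l N<l = trans (cong (sign (N ℕ.+ l) * Cℚ (N ℕ.+ l) l *_) (trans (cong ι (k>n⇒nCk≡0 N<l)) ι-0))
                           (*-zeroʳ (sign (N ℕ.+ l) * Cℚ (N ℕ.+ l) l))

-- Residues of F_{N+1} = F_N·(x+N+1)/(x-N-1):  ρ_{N+1}(l)·(N+1-l) = -ρ_N(l)·(N+1+l).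
ρ-recurrence : ∀ N l → ρ (suc N) l * gap (suc N) l ≡ - (ρ N l * (ι (suc N) + ι l))
ρ-recurrence N l = begin
    (- s) * X * Y * (A - L)
      ≡⟨ solve 5 (λ s X Y A L → (:- s) :* X :* Y :* (A :- L) := (:- s) :* X :* (Y :* A :- L :* Y)) refl s X Y A L ⟩
    (- s) * X * (Y * A - L * Y)
      ≡⟨ cong (λ t → (- s) * X * (t - L * Y)) (Cℚ-absorption-lower N l) ⟩
    (- s) * X * (L * Y + A * W - L * Y)
      ≡⟨ solve 6 (λ s X Y W A L → (:- s) :* X :* (L :* Y :+ A :* W :- L :* Y) := :- (s :* W) :* (X :* A)) refl s X Y W A L ⟩
    - (s * W) * (X * A)
      ≡⟨ cong (- (s * W) *_) (Cℚ-absorption-upper N l) ⟩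
    - (s * W) * ((A + L) * Z)
      ≡⟨ solve 5 (λ s Z W A L → :- (s :* W) :* ((A :+ L) :* Z) := :- (s :* Z :* W :* (A :+ L))) refl s Z W A L ⟩
    - (s * Z * W * (A + L)) ∎
  where
  open ≡-Reasoning
  s = sign (N ℕ.+ l)
  A = ι (suc N)
  L = ι l
  X = Cℚ (suc N ℕ.+ l) l
  Y = Cℚ (suc N) l
  Z = Cℚ (N ℕ.+ l) l
  W = Cℚ N l

ρ-step : ∀ N l → l ℕ.< suc N → ρ (suc N) l ≡ - (ρ N l * (ι (suc N) + ι l)) * recip (gap (suc N) l)
ρ-step N l l<1+N = begin
    ρ (suc N) l                          ≡⟨ sym (trans (cong (ρ (suc N) l *_) (gap-inverse (suc N) l 1+N≢l)) (*-identityʳ (ρ (suc N) l))) ⟩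
    ρ (suc N) l * (gap (suc N) l * r)     ≡⟨ sym (*-assoc (ρ (suc N) l) (gap (suc N) l) r) ⟩
    ρ (suc N) l * gap (suc N) l * r       ≡⟨ cong (_* r) (ρ-recurrence N l) ⟩
    - (ρ N l * (ι (suc N) + ι l)) * r      ∎
  where
  open ≡-Reasoning
  r = recip (gap (suc N) l)
  1+N≢l : ¬ (suc N ≡ l)
  1+N≢l 1+N≡l = ℕP.<⇒≢ l<1+N (sym 1+N≡l)

-- The regularised values of F_N and of its derivative at an integer j (the singular
-- term l = j is dropped, as recip 0 = 0):
--   G N j = Σ_{l≤N} ρ_N(l)/(l-j),   K N j = Σ_{l≤N} ρ_N(l)/(l-j)².

G : ℕ → ℕ → ℚ
G N j = Σ< (suc N) (λ l → ρ N l * recip (gap l j))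

K : ℕ → ℕ → ℚ
K N j = Σ< (suc N) (λ l → ρ N l * (recip (gap l j) * recip (gap l j)))

Σ<-ρ-δ : ∀ N j → Σ< (suc N) (λ l → ρ N l * δ l j) ≡ ρ N j
Σ<-ρ-δ N j with j ℕ.<? suc N
... | yes j<1+N = Σ<-δ (suc N) (ρ N) j j<1+N
... | no  j≮1+N = begin
    Σ< (suc N) (λ l → ρ N l * δ l j)  ≡⟨ Σ<-cong (suc N) (λ l l<1+N → trans (cong (ρ N l *_) (δ-≢ l j (l≢j l<1+N))) (*-zeroʳ (ρ N l))) ⟩
    Σ< (suc N) (λ _ → 0ℚ)             ≡⟨ Σ<-zero (suc N) ⟩
    0ℚ                                ≡⟨ sym (ρ-vanishes N j (ℕP.≤-trans (ℕP.n<1+n N) (ℕP.≮⇒≥ j≮1+N))) ⟩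
    ρ N j                             ∎
  where
  open ≡-Reasoning
  l≢j : ∀ {l} → l ℕ.< suc N → ¬ (l ≡ j)
  l≢j l<1+N l≡j = j≮1+N (subst (ℕ._< suc N) l≡j l<1+N)

-- The sums
-- G_{a}, K_{a} are expressed through G_N, K_N by splitting off the new top term l = a and
-- rewriting every other term with ρ-step and a partial-fraction decomposition.  The
-- contribution of the top term cancels against a multiple of G_N(a) by the hypothesis
-- `Balanced N`, which the induction supplies.

Balanced : ℕ → Set
Balanced N = (ι (suc N) + ι (suc N)) * G N (suc N) + ρ (suc N) (suc N) ≡ 0ℚ

module OneStep (N : ℕ) where
  a : ℕ
  a = suc N
  A : ℚ
  A = ι a

  l≢a : ∀ {l} → l ℕ.< a → ¬ (a ≡ l)
  l≢a l<a a≡l = ℕP.<⇒≢ l<a (sym a≡l)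

  G-summand-step : ∀ j l → l ℕ.< a → ¬ (j ≡ a) →
    ρ a l * recip (gap l j) ≡ - ((A + ι j) * recip (gap a j)) * (ρ N l * recip (gap l j))
                              + (A + A) * recip (gap a j) * (ρ N l * recip (gap l a))
                              + (A + A) * (recip (gap a j) * recip (gap a j)) * (ρ N l * δ l j)
  G-summand-step j l l<a j≢a with l ℕ.≟ j
  ... | yes refl = begin
      ρ a l * recip (gap l l)
        ≡⟨ trans (cong (λ t → ρ a l * recip t) (gap-self l)) (trans (cong (ρ a l *_) recip-0) (*-zeroʳ (ρ a l))) ⟩
      0ℚ
        ≡⟨ solve 4 (λ A L U r → con 0ℚ := :- ((A :+ L) :* r) :* (U :* con 0ℚ) :+ (A :+ A) :* r :* (U :* (:- r))
                                          :+ (A :+ A) :* (r :* r) :* (U :* con 1ℚ)) refl A (ι l) (ρ N l) r ⟩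
      - ((A + ι l) * r) * (ρ N l * 0ℚ) + (A + A) * r * (ρ N l * - r) + (A + A) * (r * r) * (ρ N l * 1ℚ)
        ≡⟨ cong₂ _+_ (cong₂ _+_ (cong (λ t → - ((A + ι l) * r) * (ρ N l * t)) (sym (trans (cong recip (gap-self l)) recip-0)))
                                (cong (λ t → (A + A) * r * (ρ N l * t)) (sym (recip-gap-swap l a))))
                     refl ⟩
      - ((A + ι l) * r) * (ρ N l * recip (gap l l)) + (A + A) * r * (ρ N l * recip (gap l a))
        + (A + A) * (r * r) * (ρ N l * 1ℚ) ∎
    where
    open ≡-Reasoning
    r = recip (gap a l)
  ... | no l≢j = begin
      ρ a l * r₁
        ≡⟨ cong (_* r₁) (ρ-step N l l<a) ⟩
      - (U * (A + L)) * r₂ * r₁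
        ≡⟨ solve 5 (λ U A L r₁ r₂ → :- (U :* (A :+ L)) :* r₂ :* r₁ := :- U :* ((A :+ L) :* r₂ :* r₁)) refl U A L r₁ r₂ ⟩
      - U * ((A + L) * r₂ * r₁)
        ≡⟨ cong (- U *_) (partial-fractions₁ A L J r₁ r₂ r₃ (gap-inverse l j l≢j) (gap-inverse a l (l≢a l<a))
                                              (gap-inverse a j (λ a≡j → j≢a (sym a≡j)))) ⟩
      - U * ((A + J) * r₃ * r₁ + (A + A) * r₃ * r₂)
        ≡⟨ solve 6 (λ U A J r₁ r₂ r₃ → :- U :* ((A :+ J) :* r₃ :* r₁ :+ (A :+ A) :* r₃ :* r₂) :=
              :- ((A :+ J) :* r₃) :* (U :* r₁) :+ (A :+ A) :* r₃ :* (U :* (:- r₂)) :+ (A :+ A) :* (r₃ :* r₃) :* (U :* con 0ℚ))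
              refl U A J r₁ r₂ r₃ ⟩
      - ((A + J) * r₃) * (U * r₁) + (A + A) * r₃ * (U * - r₂) + (A + A) * (r₃ * r₃) * (U * 0ℚ)
        ≡⟨ cong₂ _+_ (cong (λ t → - ((A + J) * r₃) * (U * r₁) + (A + A) * r₃ * (U * t)) (sym (recip-gap-swap l a)))
                     refl ⟩
      - ((A + J) * r₃) * (U * r₁) + (A + A) * r₃ * (U * recip (gap l a)) + (A + A) * (r₃ * r₃) * (U * 0ℚ) ∎
    where
    open ≡-Reasoning
    U = ρ N l
    L = ι l
    J = ι j
    r₁ = recip (gap l j)
    r₂ = recip (gap a l)
    r₃ = recip (gap a j)

  -- F_{N+1}(x) = F_N(x)(x+a)/(x-a) at a point j ≠ a.
  G-step : ∀ j → ¬ (j ≡ a) → Balanced N →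
    G a j ≡ - ((A + ι j) * recip (gap a j) * G N j) + (A + A) * (recip (gap a j) * recip (gap a j)) * ρ N j
  G-step j j≢a balanced = begin
      Σ< a (λ l → ρ a l * recip (gap l j)) + ρ a a * r
        ≡⟨ cong (_+ ρ a a * r) (Σ<-cong a (λ l l<a → G-summand-step j l l<a j≢a)) ⟩
      Σ< a (λ l → c₁ * (ρ N l * recip (gap l j)) + c₂ * (ρ N l * recip (gap l a)) + c₃ * (ρ N l * δ l j)) + ρ a a * r
        ≡⟨ cong (_+ ρ a a * r) (Σ<-linear₃ a c₁ c₂ c₃ (λ l → ρ N l * recip (gap l j)) (λ l → ρ N l * recip (gap l a)) (λ l → ρ N l * δ l j)) ⟩
      c₁ * G N j + c₂ * G N a + c₃ * Σ< a (λ l → ρ N l * δ l j) + ρ a a * r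
        ≡⟨ cong (λ t → c₁ * G N j + c₂ * G N a + c₃ * t + ρ a a * r) (Σ<-ρ-δ N j) ⟩
      c₁ * G N j + c₂ * G N a + c₃ * ρ N j + ρ a a * r
        ≡⟨ solve 7 (λ A r g ga u v c₁ → c₁ :* g :+ (A :+ A) :* r :* ga :+ (A :+ A) :* (r :* r) :* u :+ v :* r :=
                     c₁ :* g :+ (A :+ A) :* (r :* r) :* u :+ r :* ((A :+ A) :* ga :+ v)) refl A r (G N j) (G N a) (ρ N j) (ρ a a) c₁ ⟩
      c₁ * G N j + c₃ * ρ N j + r * ((A + A) * G N a + ρ a a)
        ≡⟨ cong (λ t → c₁ * G N j + c₃ * ρ N j + r * t) balanced ⟩
      c₁ * G N j + c₃ * ρ N j + r * 0ℚ
        ≡⟨ solve 5 (λ A J r g u → :- ((A :+ J) :* r) :* g :+ (A :+ A) :* (r :* r) :* u :+ r :* con 0ℚ :=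
                                    :- ((A :+ J) :* r :* g) :+ (A :+ A) :* (r :* r) :* u) refl A (ι j) r (G N j) (ρ N j) ⟩
      - ((A + ι j) * r * G N j) + c₃ * ρ N j ∎
    where
    open ≡-Reasoning
    r = recip (gap a j)
    c₁ = - ((A + ι j) * r)
    c₂ = (A + A) * r
    c₃ = (A + A) * (r * r)

  K-summand-step : ∀ j l → l ℕ.< a → a ℕ.< j →
    ρ a l * (recip (gap l j) * recip (gap l j))
      ≡ - ((A + ι j) * recip (gap a j)) * (ρ N l * (recip (gap l j) * recip (gap l j)))
        + (A + A) * (recip (gap a j) * recip (gap a j)) * (ρ N l * recip (gap l a))
        + - ((A + A) * (recip (gap a j) * recip (gap a j))) * (ρ N l * recip (gap l j))
  K-summand-step j l l<a a<j = begin
      ρ a l * (r₁ * r₁)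
        ≡⟨ cong (_* (r₁ * r₁)) (ρ-step N l l<a) ⟩
      - (U * (A + L)) * r₂ * (r₁ * r₁)
        ≡⟨ solve 5 (λ U A L r₁ r₂ → :- (U :* (A :+ L)) :* r₂ :* (r₁ :* r₁) := :- U :* ((A :+ L) :* r₂ :* (r₁ :* r₁))) refl U A L r₁ r₂ ⟩
      - U * ((A + L) * r₂ * (r₁ * r₁))
        ≡⟨ cong (- U *_) (partial-fractions₂ A L J r₁ r₂ r₃ (gap-inverse l j l≢j) (gap-inverse a l (l≢a l<a))
                                              (gap-inverse a j (ℕP.<⇒≢ a<j))) ⟩
      - U * ((A + A) * (r₃ * r₃) * r₂ + (A + J) * r₃ * (r₁ * r₁) + (A + A) * (r₃ * r₃) * r₁)
        ≡⟨ solve 6 (λ U A J r₁ r₂ r₃ → :- U :* ((A :+ A) :* (r₃ :* r₃) :* r₂ :+ (A :+ J) :* r₃ :* (r₁ :* r₁) :+ (A :+ A) :* (r₃ :* r₃) :* r₁) :=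
              :- ((A :+ J) :* r₃) :* (U :* (r₁ :* r₁)) :+ (A :+ A) :* (r₃ :* r₃) :* (U :* (:- r₂)) :+ :- ((A :+ A) :* (r₃ :* r₃)) :* (U :* r₁))
              refl U A J r₁ r₂ r₃ ⟩
      - ((A + J) * r₃) * (U * (r₁ * r₁)) + (A + A) * (r₃ * r₃) * (U * - r₂) + - ((A + A) * (r₃ * r₃)) * (U * r₁)
        ≡⟨ cong (λ t → - ((A + J) * r₃) * (U * (r₁ * r₁)) + (A + A) * (r₃ * r₃) * (U * t) + - ((A + A) * (r₃ * r₃)) * (U * r₁))
                (sym (recip-gap-swap l a)) ⟩
      - ((A + J) * r₃) * (U * (r₁ * r₁)) + (A + A) * (r₃ * r₃) * (U * recip (gap l a)) + - ((A + A) * (r₃ * r₃)) * (U * r₁) ∎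
    where
    open ≡-Reasoning
    U = ρ N l
    L = ι l
    J = ι j
    r₁ = recip (gap l j)
    r₂ = recip (gap a l)
    r₃ = recip (gap a j)
    l≢j : ¬ (l ≡ j)
    l≢j = ℕP.<⇒≢ (ℕP.<-trans l<a a<j)

  -- The derivative counterpart of G-step, at a point j > a.
  K-step : ∀ j → a ℕ.< j → Balanced N →
    K a j ≡ - ((A + ι j) * recip (gap a j) * K N j) - (A + A) * (recip (gap a j) * recip (gap a j)) * G N j
  K-step j a<j balanced = begin
      Σ< a (λ l → ρ a l * (recip (gap l j) * recip (gap l j))) + ρ a a * (r * r)
        ≡⟨ cong (_+ ρ a a * (r * r)) (Σ<-cong a (λ l l<a → K-summand-step j l l<a a<j)) ⟩
      Σ< a (λ l → c₁ * (ρ N l * (recip (gap l j) * recip (gap l j))) + c₂ * (ρ N l * recip (gap l a)) + c₃ * (ρ N l * recip (gap l j)))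
        + ρ a a * (r * r)
        ≡⟨ cong (_+ ρ a a * (r * r)) (Σ<-linear₃ a c₁ c₂ c₃ (λ l → ρ N l * (recip (gap l j) * recip (gap l j)))
                                                          (λ l → ρ N l * recip (gap l a)) (λ l → ρ N l * recip (gap l j))) ⟩
      c₁ * K N j + c₂ * G N a + c₃ * G N j + ρ a a * (r * r)
        ≡⟨ solve 8 (λ A r k g ga v c₁ c₃ → c₁ :* k :+ (A :+ A) :* (r :* r) :* ga :+ c₃ :* g :+ v :* (r :* r) :=
                     c₁ :* k :+ c₃ :* g :+ (r :* r) :* ((A :+ A) :* ga :+ v)) refl A r (K N j) (G N j) (G N a) (ρ a a) c₁ c₃ ⟩
      c₁ * K N j + c₃ * G N j + (r * r) * ((A + A) * G N a + ρ a a)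
        ≡⟨ cong (λ t → c₁ * K N j + c₃ * G N j + (r * r) * t) balanced ⟩
      c₁ * K N j + c₃ * G N j + (r * r) * 0ℚ
        ≡⟨ solve 5 (λ A J r k g → :- ((A :+ J) :* r) :* k :+ :- ((A :+ A) :* (r :* r)) :* g :+ (r :* r) :* con 0ℚ :=
                     :- ((A :+ J) :* r :* k) :- (A :+ A) :* (r :* r) :* g) refl A (ι j) r (K N j) (G N j) ⟩
      - ((A + ι j) * r * K N j) - (A + A) * (r * r) * G N j ∎
    where
    open ≡-Reasoning
    r = recip (gap a j)
    c₁ = - ((A + ι j) * r)
    c₂ = (A + A) * (r * r)
    c₃ = - ((A + A) * (r * r))

  G-diag-summand-step : ∀ l → l ℕ.< a →
    ρ a l * recip (gap l a) ≡ (A + A) * (ρ N l * (recip (gap l a) * recip (gap l a))) + 1ℚ * (ρ N l * recip (gap l a))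
  G-diag-summand-step l l<a = begin
      ρ a l * recip (gap l a)
        ≡⟨ cong₂ _*_ (ρ-step N l l<a) (recip-gap-swap l a) ⟩
      - (U * (A + L)) * r * - r
        ≡⟨ solve 4 (λ U A L r → :- (U :* (A :+ L)) :* r :* (:- r) :=
                 (A :+ A) :* (U :* ((:- r) :* (:- r))) :+ con 1ℚ :* (U :* (:- r)) :* ((A :- L) :* r)) refl U A L r ⟩
      (A + A) * (U * (- r * - r)) + 1ℚ * (U * - r) * ((A - L) * r)
        ≡⟨ cong ((A + A) * (U * (- r * - r)) +_)
                (trans (cong (1ℚ * (U * - r) *_) (gap-inverse a l (l≢a l<a))) (*-identityʳ (1ℚ * (U * - r)))) ⟩
      (A + A) * (U * (- r * - r)) + 1ℚ * (U * - r)
        ≡⟨ cong (λ t → (A + A) * (U * (t * t)) + 1ℚ * (U * t)) (sym (recip-gap-swap l a)) ⟩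
      (A + A) * (U * (recip (gap l a) * recip (gap l a))) + 1ℚ * (U * recip (gap l a)) ∎
    where
    open ≡-Reasoning
    U = ρ N l
    L = ι l
    r = recip (gap a l)

  G-diag-step : G a a ≡ (A + A) * K N a + G N a
  G-diag-step = begin
      Σ< a (λ l → ρ a l * recip (gap l a)) + ρ a a * recip (gap a a)
        ≡⟨ cong₂ _+_ (Σ<-cong a G-diag-summand-step)
                     (trans (cong (λ t → ρ a a * recip t) (gap-self a)) (trans (cong (ρ a a *_) recip-0) (*-zeroʳ (ρ a a)))) ⟩
      Σ< a (λ l → (A + A) * (ρ N l * (recip (gap l a) * recip (gap l a))) + 1ℚ * (ρ N l * recip (gap l a))) + 0ℚ
        ≡⟨ trans (+-identityʳ _) (Σ<-linear₂ a (A + A) 1ℚ (λ l → ρ N l * (recip (gap l a) * recip (gap l a))) (λ l → ρ N l * recip (gap l a))) ⟩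
      (A + A) * K N a + 1ℚ * G N a
        ≡⟨ cong ((A + A) * K N a +_) (*-identityˡ (G N a)) ⟩
      (A + A) * K N a + G N a ∎
    where open ≡-Reasoning

  ρ-summand-step : ∀ l → l ℕ.< a → ρ a l ≡ 1ℚ * ρ N l + (A + A) * (ρ N l * recip (gap l a))
  ρ-summand-step l l<a = begin
      ρ a l
        ≡⟨ ρ-step N l l<a ⟩
      - (U * (A + L)) * r
        ≡⟨ solve 4 (λ U A L r → :- (U :* (A :+ L)) :* r := con 1ℚ :* (U :* ((A :- L) :* r)) :+ (A :+ A) :* (U :* (:- r))) refl U A L r ⟩
      1ℚ * (U * ((A - L) * r)) + (A + A) * (U * - r)
        ≡⟨ cong₂ (λ x y → 1ℚ * (U * x) + (A + A) * (U * y)) (gap-inverse a l (l≢a l<a)) (sym (recip-gap-swap l a)) ⟩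
      1ℚ * (U * 1ℚ) + (A + A) * (U * recip (gap l a))
        ≡⟨ cong (λ x → 1ℚ * x + (A + A) * (U * recip (gap l a))) (*-identityʳ U) ⟩
      1ℚ * U + (A + A) * (U * recip (gap l a)) ∎
    where
    open ≡-Reasoning
    U = ρ N l
    L = ι l
    r = recip (gap a l)

  -- The residues of F_{a} still sum to 1 (the leading coefficient of F_a·x is 1).
  Σρ-step : Σ< a (ρ N) ≡ 1ℚ → Balanced N → Σ< (suc a) (ρ a) ≡ 1ℚ
  Σρ-step Σρ≡1 balanced = begin
      Σ< a (ρ a) + ρ a a
        ≡⟨ cong (_+ ρ a a) (trans (Σ<-cong a ρ-summand-step) (Σ<-linear₂ a 1ℚ (A + A) (ρ N) (λ l → ρ N l * recip (gap l a)))) ⟩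
      1ℚ * Σ< a (ρ N) + (A + A) * G N a + ρ a a
        ≡⟨ cong (λ t → 1ℚ * t + (A + A) * G N a + ρ a a) Σρ≡1 ⟩
      1ℚ * 1ℚ + (A + A) * G N a + ρ a a
        ≡⟨ solve 3 (λ A g v → con 1ℚ :* con 1ℚ :+ (A :+ A) :* g :+ v := con 1ℚ :+ ((A :+ A) :* g :+ v)) refl A (G N a) (ρ a a) ⟩
      1ℚ + ((A + A) * G N a + ρ a a)
        ≡⟨ cong (1ℚ +_) balanced ⟩
      1ℚ + 0ℚ
        ≡⟨ +-identityʳ 1ℚ ⟩
      1ℚ ∎
    where open ≡-Reasoning

-- Harmonic numbers H_n = Σ_{i=1}^{n} 1/i, and the two combinations occurring in the
-- invariant: the finite part inside the range of poles, and the value outside it,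
--   hIn  N j = H_{N+j} + H_{N-j} - 2H_j,     hOut N j = H_{N+j} + H_{j-N-1} - 2H_j.

Hℚ : ℕ → ℚ
Hℚ zero    = 0ℚ
Hℚ (suc n) = Hℚ n + recip (ι (suc n))

hIn : ℕ → ℕ → ℚ
hIn N j = Hℚ (N ℕ.+ j) + Hℚ (N ∸ j) - (1ℚ + 1ℚ) * Hℚ j

hOut : ℕ → ℕ → ℚ
hOut N j = Hℚ (N ℕ.+ j) + Hℚ (j ∸ suc N) - (1ℚ + 1ℚ) * Hℚ j

-- Both change by the logarithmic derivative 1/(j+a) + 1/(a-j) of (x+a)/(x-a) when N ↦ a = N+1.

hIn-step : ∀ N j → j ℕ.≤ N → hIn (suc N) j ≡ hIn N j + recip (ι (suc N) + ι j) + recip (gap (suc N) j)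
hIn-step N j j≤N = begin
    Hℚ (N ℕ.+ j) + recip (ι (suc N ℕ.+ j)) + Hℚ (suc N ∸ j) - two * Hℚ j
      ≡⟨ cong₂ (λ s t → Hℚ (N ℕ.+ j) + recip s + t - two * Hℚ j) (ι-+ (suc N) j) H[1+N-j] ⟩
    Hℚ (N ℕ.+ j) + recip (ι (suc N) + ι j) + (Hℚ (N ∸ j) + recip (gap (suc N) j)) - two * Hℚ j
      ≡⟨ solve 6 (λ x s y z r t → x :+ s :+ (y :+ r) :- t :* z := x :+ y :- t :* z :+ s :+ r)
            refl (Hℚ (N ℕ.+ j)) (recip (ι (suc N) + ι j)) (Hℚ (N ∸ j)) (Hℚ j) (recip (gap (suc N) j)) two ⟩
    hIn N j + recip (ι (suc N) + ι j) + recip (gap (suc N) j) ∎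
  where
  open ≡-Reasoning
  two = 1ℚ + 1ℚ
  1+N-j : suc N ∸ j ≡ suc (N ∸ j)
  1+N-j = ℕP.+-∸-assoc 1 j≤N
  H[1+N-j] : Hℚ (suc N ∸ j) ≡ Hℚ (N ∸ j) + recip (gap (suc N) j)
  H[1+N-j] = trans (cong Hℚ 1+N-j) (cong (λ t → Hℚ (N ∸ j) + recip t)
               (trans (cong ι (sym 1+N-j)) (ι-∸ (suc N) j (ℕP.≤-trans j≤N (ℕP.n≤1+n N)))))

hOut-step : ∀ N j → suc N ℕ.< j → hOut (suc N) j ≡ hOut N j + recip (ι (suc N) + ι j) + recip (gap (suc N) j)
hOut-step N j a<j = begin
    Hℚ (N ℕ.+ j) + recip (ι (suc N ℕ.+ j)) + Y - two * Hℚ j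
      ≡⟨ cong (λ s → Hℚ (N ℕ.+ j) + recip s + Y - two * Hℚ j) (ι-+ (suc N) j) ⟩
    Hℚ (N ℕ.+ j) + recip (ι (suc N) + ι j) + Y - two * Hℚ j
      ≡⟨ solve 6 (λ x s y z r t → x :+ s :+ y :- t :* z := x :+ (y :+ (:- r)) :- t :* z :+ s :+ r)
            refl (Hℚ (N ℕ.+ j)) (recip (ι (suc N) + ι j)) Y (Hℚ j) (recip (gap (suc N) j)) two ⟩
    Hℚ (N ℕ.+ j) + (Y + - recip (gap (suc N) j)) - two * Hℚ j + recip (ι (suc N) + ι j) + recip (gap (suc N) j)
      ≡⟨ cong (λ t → Hℚ (N ℕ.+ j) + t - two * Hℚ j + recip (ι (suc N) + ι j) + recip (gap (suc N) j)) (sym H[j-1-N]) ⟩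
    hOut N j + recip (ι (suc N) + ι j) + recip (gap (suc N) j) ∎
  where
  open ≡-Reasoning
  two = 1ℚ + 1ℚ
  Y = Hℚ (j ∸ suc (suc N))
  j-1-N : j ∸ suc N ≡ suc (j ∸ suc (suc N))
  j-1-N = ℕP.+-∸-assoc 1 a<j
  H[j-1-N] : Hℚ (j ∸ suc N) ≡ Y + - recip (gap (suc N) j)
  H[j-1-N] = trans (cong Hℚ j-1-N) (cong (Y +_)
    (trans (cong recip (trans (cong ι (sym j-1-N)) (ι-∸ j (suc N) (ℕP.<⇒≤ a<j)))) (recip-gap-swap j (suc N))))

hIn-diag : ∀ N → hIn (suc N) (suc N) ≡ hOut N (suc N) + recip (ι (suc N) + ι (suc N))
hIn-diag N = begin
    Hℚ (N ℕ.+ a) + recip (ι (a ℕ.+ a)) + Hℚ (a ∸ a) - two * Hℚ a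
      ≡⟨ cong (λ s → Hℚ (N ℕ.+ a) + recip s + Hℚ (a ∸ a) - two * Hℚ a) (ι-+ a a) ⟩
    Hℚ (N ℕ.+ a) + recip (ι a + ι a) + Hℚ (a ∸ a) - two * Hℚ a
      ≡⟨ solve 5 (λ x s y z t → x :+ s :+ y :- t :* z := x :+ y :- t :* z :+ s)
            refl (Hℚ (N ℕ.+ a)) (recip (ι a + ι a)) (Hℚ (a ∸ a)) (Hℚ a) two ⟩
    hOut N a + recip (ι a + ι a) ∎
  where
  open ≡-Reasoning
  a = suc N
  two = 1ℚ + 1ℚ

-- Each one multiplies an invariant for
-- a = N+1 by A = ι a, so that the binomial absorption identities can be applied, and
-- reduces it to the corresponding invariant for N.  Notation: J = ι j, r = 1/(a-j),
-- s = 1/(a+j), C⁺ = C(j-1,a), C₀ = C(j-1,N), P = C(N+j,j), P⁺ = C(a+j,j).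

-- j·C(j-1,a)·G_a(j) = -C(a+j,j) from the same statement for N (j > a).
G-outside-algebra : ∀ J A C⁺ C₀ g r P P⁺ →
  A * C⁺ ≡ (J - A) * C₀ → (A - J) * r ≡ 1ℚ → P⁺ * A ≡ (A + J) * P → J * C₀ * g ≡ - P →
  (J * C⁺ * (- ((A + J) * r * g))) * A ≡ (- P⁺) * A
G-outside-algebra J A C⁺ C₀ g r P P⁺ absorb r-inv P⁺-absorb previous = begin
    (J * C⁺ * (- ((A + J) * r * g))) * A
      ≡⟨ solve 4 (λ J C⁺ X A → (J :* C⁺ :* X) :* A := J :* X :* (A :* C⁺)) refl J C⁺ (- ((A + J) * r * g)) A ⟩
    J * (- ((A + J) * r * g)) * (A * C⁺)
      ≡⟨ cong (J * (- ((A + J) * r * g)) *_) absorb ⟩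
    J * (- ((A + J) * r * g)) * ((J - A) * C₀)
      ≡⟨ solve 5 (λ J A C₀ g r → J :* (:- ((A :+ J) :* r :* g)) :* ((J :- A) :* C₀) :=
            (A :+ J) :* ((A :- J) :* r) :* (J :* C₀ :* g)) refl J A C₀ g r ⟩
    (A + J) * ((A - J) * r) * (J * C₀ * g)
      ≡⟨ cong₂ (λ x y → (A + J) * x * y) r-inv previous ⟩
    (A + J) * 1ℚ * (- P)
      ≡⟨ solve 3 (λ A J P → (A :+ J) :* con 1ℚ :* (:- P) := :- ((A :+ J) :* P)) refl A J P ⟩
    - ((A + J) * P)
      ≡⟨ cong -_ (sym P⁺-absorb) ⟩
    - (P⁺ * A)
      ≡⟨ neg-distribˡ-* P⁺ A ⟩
    (- P⁺) * A ∎
  where open ≡-Reasoning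

-- j·C(j-1,a)·K_a(j) = -C(a+j,j)·hOut from the statements for N (j > a).
K-outside-algebra : ∀ J A C⁺ C₀ k g r s P P⁺ h →
  A * C⁺ ≡ (J - A) * C₀ → (A - J) * r ≡ 1ℚ → (A + J) * s ≡ 1ℚ → P⁺ * A ≡ (A + J) * P →
  J * C₀ * k ≡ - (P * h) → J * C₀ * g ≡ - P →
  (J * C⁺ * (- ((A + J) * r * k) - (A + A) * (r * r) * g)) * A ≡ (- (P⁺ * (h + s + r))) * A
K-outside-algebra J A C⁺ C₀ k g r s P P⁺ h absorb r-inv s-inv P⁺-absorb previousK previousG = begin
    (J * C⁺ * X) * A
      ≡⟨ solve 4 (λ J C⁺ X A → (J :* C⁺ :* X) :* A := J :* X :* (A :* C⁺)) refl J C⁺ X A ⟩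
    J * X * (A * C⁺)
      ≡⟨ cong (J * X *_) absorb ⟩
    J * X * ((J - A) * C₀)
      ≡⟨ solve 6 (λ J A C₀ k g r → J :* (:- ((A :+ J) :* r :* k) :- (A :+ A) :* (r :* r) :* g) :* ((J :- A) :* C₀) :=
            (A :+ J) :* ((A :- J) :* r) :* (J :* C₀ :* k) :+ (A :+ A) :* r :* ((A :- J) :* r) :* (J :* C₀ :* g)) refl J A C₀ k g r ⟩
    (A + J) * ((A - J) * r) * (J * C₀ * k) + (A + A) * r * ((A - J) * r) * (J * C₀ * g)
      ≡⟨ cong₂ _+_ (cong₂ (λ x y → (A + J) * x * y) r-inv previousK) (cong₂ (λ x y → (A + A) * r * x * y) r-inv previousG) ⟩
    (A + J) * 1ℚ * (- (P * h)) + (A + A) * r * 1ℚ * (- P)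
      ≡⟨ solve 5 (λ A J P h r → (A :+ J) :* con 1ℚ :* (:- (P :* h)) :+ (A :+ A) :* r :* con 1ℚ :* (:- P) :=
            :- ((A :+ J) :* P :* h) :- P :* ((A :- J) :* r) :- (A :+ J) :* P :* r) refl A J P h r ⟩
    - ((A + J) * P * h) - P * ((A - J) * r) - (A + J) * P * r
      ≡⟨ cong (λ x → - ((A + J) * P * h) - P * x - (A + J) * P * r) (trans r-inv (sym s-inv)) ⟩
    - ((A + J) * P * h) - P * ((A + J) * s) - (A + J) * P * r
      ≡⟨ solve 6 (λ A J P h s r → :- ((A :+ J) :* P :* h) :- P :* ((A :+ J) :* s) :- (A :+ J) :* P :* r :=
            :- (((A :+ J) :* P) :* (h :+ s :+ r))) refl A J P h s r ⟩
    - (((A + J) * P) * (h + s + r))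
      ≡⟨ cong (λ x → - (x * (h + s + r))) (sym P⁺-absorb) ⟩
    - ((P⁺ * A) * (h + s + r))
      ≡⟨ solve 3 (λ P⁺ A t → :- ((P⁺ :* A) :* t) := (:- (P⁺ :* t)) :* A) refl P⁺ A (h + s + r) ⟩
    (- (P⁺ * (h + s + r))) * A ∎
  where
  open ≡-Reasoning
  X = - ((A + J) * r * k) - (A + A) * (r * r) * g

-- G_a(j) = -ρ_a(j)·hIn from the statement for N, for j < a; here u = ρ_N(j).
G-inside-algebra : ∀ A J u r s h → (A - J) * r ≡ 1ℚ → (A + J) * s ≡ 1ℚ →
  - ((A + J) * r * (- (u * h))) + (A + A) * (r * r) * u ≡ - ((- (u * (A + J)) * r) * (h + s + r))
G-inside-algebra A J u r s h r-inv s-inv = begin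
    - ((A + J) * r * (- (u * h))) + (A + A) * (r * r) * u
      ≡⟨ solve 5 (λ A J u r h → :- ((A :+ J) :* r :* (:- (u :* h))) :+ (A :+ A) :* (r :* r) :* u :=
            (A :+ J) :* r :* u :* h :+ u :* r :* ((A :- J) :* r) :+ u :* (A :+ J) :* (r :* r)) refl A J u r h ⟩
    (A + J) * r * u * h + u * r * ((A - J) * r) + u * (A + J) * (r * r)
      ≡⟨ cong (λ x → (A + J) * r * u * h + u * r * x + u * (A + J) * (r * r)) (trans r-inv (sym s-inv)) ⟩
    (A + J) * r * u * h + u * r * ((A + J) * s) + u * (A + J) * (r * r)
      ≡⟨ solve 6 (λ A J u r s h → (A :+ J) :* r :* u :* h :+ u :* r :* ((A :+ J) :* s) :+ u :* (A :+ J) :* (r :* r) :=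
            :- ((:- (u :* (A :+ J)) :* r) :* (h :+ s :+ r))) refl A J u r s h ⟩
    - ((- (u * (A + J)) * r) * (h + s + r)) ∎
  where open ≡-Reasoning

-- G_a(a) = -ρ_a(a)·hIn at the new pole, with Q = C(N+a,a), ρ_a(a) = 2Q and s = 1/(2a).
G-diag-algebra : ∀ A k g Q h s → A * k ≡ - (Q * h) → A * g ≡ - Q → (A + A) * s ≡ 1ℚ →
  ((A + A) * k + g) * A ≡ (- (((1ℚ + 1ℚ) * Q) * (h + s))) * A
G-diag-algebra A k g Q h s previousK previousG s-inv = begin
    ((A + A) * k + g) * A
      ≡⟨ solve 3 (λ A k g → ((A :+ A) :* k :+ g) :* A := (A :+ A) :* (A :* k) :+ A :* g) refl A k g ⟩
    (A + A) * (A * k) + A * g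
      ≡⟨ cong₂ (λ x y → (A + A) * x + y) previousK previousG ⟩
    (A + A) * (- (Q * h)) + - Q
      ≡⟨ cong (λ x → (A + A) * (- (Q * h)) + - x) (trans (sym (*-identityʳ Q)) (cong (Q *_) (sym s-inv))) ⟩
    (A + A) * (- (Q * h)) + - (Q * ((A + A) * s))
      ≡⟨ solve 4 (λ A Q h s → (A :+ A) :* (:- (Q :* h)) :+ :- (Q :* ((A :+ A) :* s)) :=
            (:- (((con 1ℚ :+ con 1ℚ) :* Q) :* (h :+ s))) :* A) refl A Q h s ⟩
    (- (((1ℚ + 1ℚ) * Q) * (h + s))) * A ∎
  where open ≡-Reasoning

-- The hypothesis Balanced N follows from  a·G_N(a) = -Q  and  ρ_a(a) = 2Q.
balanced-algebra : ∀ A g Q v → A * g ≡ - Q → v ≡ (1ℚ + 1ℚ) * Q → (A + A) * g + v ≡ 0ℚ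
balanced-algebra A g Q v previousG top = begin
    (A + A) * g + v
      ≡⟨ cong (_+ v) (solve 2 (λ A g → (A :+ A) :* g := (con 1ℚ :+ con 1ℚ) :* (A :* g)) refl A g) ⟩
    (1ℚ + 1ℚ) * (A * g) + v
      ≡⟨ cong₂ (λ x y → (1ℚ + 1ℚ) * x + y) previousG top ⟩
    (1ℚ + 1ℚ) * (- Q) + (1ℚ + 1ℚ) * Q
      ≡⟨ solve 1 (λ Q → (con 1ℚ :+ con 1ℚ) :* (:- Q) :+ (con 1ℚ :+ con 1ℚ) :* Q := con 0ℚ) refl Q ⟩
    0ℚ ∎
  where open ≡-Reasoning

-- The induction on N.  For j > N, G_N(j) = -F_N(j) with F_N(j) = C(N+j,j)/(j·C(j-1,N)),
-- and K_N(j) = -F_N′(j); for j ≤ N, -G_N(j) is the finite part of F_N at its pole j.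

record Invariant (N : ℕ) : Set where
  field
    Σρ≡1      : Σ< (suc N) (ρ N) ≡ 1ℚ
    G-outside : ∀ j → N ℕ.< j → ι j * Cℚ (j ∸ 1) N * G N j ≡ - Cℚ (N ℕ.+ j) j
    K-outside : ∀ j → N ℕ.< j → ι j * Cℚ (j ∸ 1) N * K N j ≡ - (Cℚ (N ℕ.+ j) j * hOut N j)
    G-inside  : ∀ j → j ℕ.≤ N → G N j ≡ - (ρ N j * hIn N j)

-- F_0(x) = 1/x.
invariant-0 : Invariant 0
invariant-0 = record { Σρ≡1 = Σρ≡1 ; G-outside = G-outside ; K-outside = K-outside ; G-inside = G-inside }
  where
  open ≡-Reasoning
  ρ-0-0 : ρ 0 0 ≡ 1ℚ
  ρ-0-0 = cong (λ x → 1ℚ * x * x) ι-1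
  recip-gap-0 : ∀ j → recip (gap 0 j) ≡ - recip (ι j)
  recip-gap-0 j = trans (cong recip (trans (cong (_- ι j) ι-0) (solve 1 (λ x → con 0ℚ :- x := :- x) refl (ι j)))) (recip-neg (ι j))
  Σρ≡1 : Σ< 1 (ρ 0) ≡ 1ℚ
  Σρ≡1 = cong (0ℚ +_) ρ-0-0
  G-outside : ∀ j → 0 ℕ.< j → ι j * Cℚ (j ∸ 1) 0 * G 0 j ≡ - Cℚ (0 ℕ.+ j) j
  G-outside (suc j) _ = begin
      J * Cℚ j 0 * (0ℚ + ρ 0 0 * recip (gap 0 (suc j)))
        ≡⟨ cong₂ (λ x y → J * ι 1 * (0ℚ + x * y)) ρ-0-0 (recip-gap-0 (suc j)) ⟩
      J * ι 1 * (0ℚ + 1ℚ * - r)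
        ≡⟨ cong (λ x → J * x * (0ℚ + 1ℚ * - r)) ι-1 ⟩
      J * 1ℚ * (0ℚ + 1ℚ * - r)
        ≡⟨ solve 2 (λ J r → J :* con 1ℚ :* (con 0ℚ :+ con 1ℚ :* (:- r)) := :- (J :* r)) refl J r ⟩
      - (J * r)
        ≡⟨ cong -_ (trans (recip-inverse J (ι-suc≢0 j)) (sym (Cℚ-diagonal (suc j)))) ⟩
      - Cℚ (suc j) (suc j) ∎
    where
    J = ι (suc j)
    r = recip J
  K-outside : ∀ j → 0 ℕ.< j → ι j * Cℚ (j ∸ 1) 0 * K 0 j ≡ - (Cℚ (0 ℕ.+ j) j * hOut 0 j)
  K-outside (suc j) _ = begin
      J * Cℚ j 0 * (0ℚ + ρ 0 0 * (recip (gap 0 (suc j)) * recip (gap 0 (suc j))))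
        ≡⟨ cong₂ (λ x y → J * ι 1 * (0ℚ + x * (y * y))) ρ-0-0 (recip-gap-0 (suc j)) ⟩
      J * ι 1 * (0ℚ + 1ℚ * (- r * - r))
        ≡⟨ cong (λ x → J * x * (0ℚ + 1ℚ * (- r * - r))) ι-1 ⟩
      J * 1ℚ * (0ℚ + 1ℚ * (- r * - r))
        ≡⟨ solve 2 (λ J r → J :* con 1ℚ :* (con 0ℚ :+ con 1ℚ :* ((:- r) :* (:- r))) := (J :* r) :* r) refl J r ⟩
      (J * r) * r
        ≡⟨ cong (_* r) (recip-inverse J (ι-suc≢0 j)) ⟩
      1ℚ * r
        ≡⟨ solve 2 (λ H r → con 1ℚ :* r := :- (con 1ℚ :* (H :+ r :+ H :- (con 1ℚ :+ con 1ℚ) :* (H :+ r)))) refl (Hℚ j) r ⟩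
      - (1ℚ * hOut 0 (suc j))
        ≡⟨ cong (λ x → - (x * hOut 0 (suc j))) (sym (Cℚ-diagonal (suc j))) ⟩
      - (Cℚ (suc j) (suc j) * hOut 0 (suc j)) ∎
    where
    J = ι (suc j)
    r = recip J
  G-inside : ∀ j → j ℕ.≤ 0 → G 0 j ≡ - (ρ 0 j * hIn 0 j)
  G-inside zero _ = begin
      0ℚ + ρ 0 0 * recip (gap 0 0)
        ≡⟨ cong (λ t → 0ℚ + ρ 0 0 * recip t) (gap-self 0) ⟩
      0ℚ + ρ 0 0 * recip 0ℚ
        ≡⟨ cong (λ t → 0ℚ + ρ 0 0 * t) recip-0 ⟩
      0ℚ + ρ 0 0 * 0ℚ
        ≡⟨ solve 1 (λ u → con 0ℚ :+ u :* con 0ℚ := :- (u :* (con 0ℚ :+ con 0ℚ :- (con 1ℚ :+ con 1ℚ) :* con 0ℚ))) refl (ρ 0 0) ⟩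
      - (ρ 0 0 * (0ℚ + 0ℚ - (1ℚ + 1ℚ) * 0ℚ)) ∎

module InvariantStep (N : ℕ) (IH : Invariant N) where
  open OneStep N
  open Invariant IH
  open ≡-Reasoning

  Q : ℚ
  Q = Cℚ (N ℕ.+ a) a

  a-G-outside : A * G N a ≡ - Q
  a-G-outside = trans (sym (trans (cong (λ x → A * x * G N a) (Cℚ-diagonal N)) (cong (_* G N a) (*-identityʳ A)))) (G-outside a (ℕP.n<1+n N))

  a-K-outside : A * K N a ≡ - (Q * hOut N a)
  a-K-outside = trans (sym (trans (cong (λ x → A * x * K N a) (Cℚ-diagonal N)) (cong (_* K N a) (*-identityʳ A)))) (K-outside a (ℕP.n<1+n N))

  ρ-top : ρ a a ≡ (1ℚ + 1ℚ) * Q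
  ρ-top = begin
      sign (a ℕ.+ a) * Cℚ (a ℕ.+ a) a * Cℚ a a
        ≡⟨ cong₂ (λ x y → x * Cℚ (a ℕ.+ a) a * y) (sign-double a) (Cℚ-diagonal a) ⟩
      1ℚ * Cℚ (a ℕ.+ a) a * 1ℚ
        ≡⟨ solve 1 (λ x → con 1ℚ :* x :* con 1ℚ := x) refl (Cℚ (a ℕ.+ a) a) ⟩
      Cℚ (a ℕ.+ a) a
        ≡⟨ Cℚ-central N ⟩
      (1ℚ + 1ℚ) * Q ∎

  balanced : Balanced N
  balanced = balanced-algebra A (G N a) Q (ρ a a) a-G-outside ρ-top

  module Outside (j : ℕ) (a<j : a ℕ.< j) where
    N<j : N ℕ.< j
    N<j = ℕP.<-trans (ℕP.n<1+n N) a<j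
    J C⁺ P⁺ r : ℚ
    J = ι j
    C⁺ = Cℚ (j ∸ 1) a
    P⁺ = Cℚ (a ℕ.+ j) j
    r = recip (gap a j)

    r-inverse : (A - J) * r ≡ 1ℚ
    r-inverse = gap-inverse a j (ℕP.<⇒≢ a<j)

    G-outside′ : J * C⁺ * G a j ≡ - P⁺
    G-outside′ = *-cancelʳ-≢0 _ _ A (ι-suc≢0 N) (begin
        (J * C⁺ * G a j) * A
          ≡⟨ cong (λ t → (J * C⁺ * t) * A) G-step-outside ⟩
        (J * C⁺ * (- ((A + J) * r * G N j))) * A
          ≡⟨ G-outside-algebra J A C⁺ (Cℚ (j ∸ 1) N) (G N j) r (Cℚ (N ℕ.+ j) j) P⁺
               (Cℚ-absorption-sum N j a<j) r-inverse (Cℚ-absorption-upper N j) (G-outside j N<j) ⟩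
        (- P⁺) * A ∎)
      where
      G-step-outside : G a j ≡ - ((A + J) * r * G N j)
      G-step-outside = begin
          G a j
            ≡⟨ G-step j (λ j≡a → ℕP.<⇒≢ a<j (sym j≡a)) balanced ⟩
          - ((A + J) * r * G N j) + (A + A) * (r * r) * ρ N j
            ≡⟨ cong (λ t → - ((A + J) * r * G N j) + (A + A) * (r * r) * t) (ρ-vanishes N j N<j) ⟩
          - ((A + J) * r * G N j) + (A + A) * (r * r) * 0ℚ
            ≡⟨ solve 2 (λ x y → x :+ y :* con 0ℚ := x) refl (- ((A + J) * r * G N j)) ((A + A) * (r * r)) ⟩
          - ((A + J) * r * G N j) ∎

    K-outside′ : J * C⁺ * K a j ≡ - (P⁺ * hOut a j)
    K-outside′ = *-cancelʳ-≢0 _ _ A (ι-suc≢0 N) (begin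
        (J * C⁺ * K a j) * A
          ≡⟨ cong (λ t → (J * C⁺ * t) * A) (K-step j a<j balanced) ⟩
        (J * C⁺ * (- ((A + J) * r * K N j) - (A + A) * (r * r) * G N j)) * A
          ≡⟨ K-outside-algebra J A C⁺ (Cℚ (j ∸ 1) N) (K N j) (G N j) r (recip (A + J)) (Cℚ (N ℕ.+ j) j) P⁺ (hOut N j)
               (Cℚ-absorption-sum N j a<j) r-inverse (recip-inverse (A + J) (ι-suc+≢0 N j)) (Cℚ-absorption-upper N j)
               (K-outside j N<j) (G-outside j N<j) ⟩
        (- (P⁺ * (hOut N j + recip (A + J) + r))) * A
          ≡⟨ cong (λ t → (- (P⁺ * t)) * A) (sym (hOut-step N j a<j)) ⟩
        (- (P⁺ * hOut a j)) * A ∎)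

  G-inside′ : ∀ j → j ℕ.≤ a → G a j ≡ - (ρ a j * hIn a j)
  G-inside′ j j≤a with j ℕ.≟ a
  ... | yes refl = *-cancelʳ-≢0 _ _ A (ι-suc≢0 N) (begin
        G a a * A
          ≡⟨ cong (_* A) G-diag-step ⟩
        ((A + A) * K N a + G N a) * A
          ≡⟨ G-diag-algebra A (K N a) (G N a) Q (hOut N a) (recip (A + A)) a-K-outside a-G-outside
                            (recip-inverse (A + A) (ι-suc+≢0 N a)) ⟩
        (- (((1ℚ + 1ℚ) * Q) * (hOut N a + recip (A + A)))) * A
          ≡⟨ cong₂ (λ x y → (- (x * y)) * A) (sym ρ-top) (sym (hIn-diag N)) ⟩
        (- (ρ a a * hIn a a)) * A ∎)
  ... | no j≢a = begin
        G a j
          ≡⟨ G-step j j≢a balanced ⟩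
        - ((A + ι j) * r * G N j) + (A + A) * (r * r) * ρ N j
          ≡⟨ cong (λ x → - ((A + ι j) * r * x) + (A + A) * (r * r) * ρ N j) (G-inside j j≤N) ⟩
        - ((A + ι j) * r * (- (ρ N j * hIn N j))) + (A + A) * (r * r) * ρ N j
          ≡⟨ G-inside-algebra A (ι j) (ρ N j) r (recip (A + ι j)) (hIn N j)
               (gap-inverse a j (λ a≡j → j≢a (sym a≡j))) (recip-inverse (A + ι j) (ι-suc+≢0 N j)) ⟩
        - ((- (ρ N j * (A + ι j)) * r) * (hIn N j + recip (A + ι j) + r))
          ≡⟨ cong₂ (λ x y → - (x * y)) (sym (ρ-step N j j<a)) (sym (hIn-step N j j≤N)) ⟩
        - (ρ a j * hIn a j) ∎
    where
    r = recip (gap a j)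
    j<a : j ℕ.< a
    j<a = ℕP.≤∧≢⇒< j≤a j≢a
    j≤N : j ℕ.≤ N
    j≤N = ℕP.≤-pred j<a

  invariant-suc : Invariant a
  invariant-suc = record
    { Σρ≡1      = Σρ-step Σρ≡1 balanced
    ; G-outside = Outside.G-outside′
    ; K-outside = Outside.K-outside′
    ; G-inside  = G-inside′
    }

invariant : ∀ N → Invariant N
invariant zero    = invariant-0
invariant (suc N) = InvariantStep.invariant-suc N (invariant N)

-- Writing out G_n, G_m as sums over l and exchanging the order of summation in the second,
-- the cross terms combine to Σ_{k,l} ρ_m(k)ρ_n(l)(k/(l-k) + l/(k-l)), and the kernel is
-- [k = l] - 1; the sifting property and Σρ = 1 give Σ_{k≤m} X_k = 1.

symmetric-kernel : ∀ k l → ι k * recip (gap l k) + ι l * recip (gap k l) ≡ δ l k - 1ℚ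
symmetric-kernel k l with l ℕ.≟ k
... | yes refl = begin
    ι l * recip (gap l l) + ι l * recip (gap l l)
      ≡⟨ cong (λ t → ι l * recip t + ι l * recip t) (gap-self l) ⟩
    ι l * recip 0ℚ + ι l * recip 0ℚ
      ≡⟨ cong (λ t → ι l * t + ι l * t) recip-0 ⟩
    ι l * 0ℚ + ι l * 0ℚ
      ≡⟨ solve 1 (λ x → x :* con 0ℚ :+ x :* con 0ℚ := con 1ℚ :- con 1ℚ) refl (ι l) ⟩
    1ℚ - 1ℚ ∎
  where open ≡-Reasoning
... | no l≢k = begin
    ι k * recip (gap l k) + ι l * recip (gap k l)
      ≡⟨ cong (λ t → ι k * recip (gap l k) + ι l * t) (recip-gap-swap k l) ⟩
    ι k * recip (gap l k) + ι l * - recip (gap l k)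
      ≡⟨ solve 3 (λ K L r → K :* r :+ L :* (:- r) := con 0ℚ :- (L :- K) :* r) refl (ι k) (ι l) (recip (gap l k)) ⟩
    0ℚ - gap l k * recip (gap l k)
      ≡⟨ cong (λ t → 0ℚ - t) (gap-inverse l k l≢k) ⟩
    0ℚ - 1ℚ ∎
  where open ≡-Reasoning

module DoubleSum (m n : ℕ) (n≤m : n ℕ.≤ m) where
  open ≡-Reasoning

  M : ℕ
  M = suc m

  X : ℕ → ℚ
  X k = ρ m k * ρ n k - ι k * (ρ m k * G n k + ρ n k * G m k)

  extend : ∀ (f : ℕ → ℚ) → (∀ l → suc n ℕ.≤ l → f l ≡ 0ℚ) → Σ< M f ≡ Σ< (suc n) f
  extend f vanish = trans (cong (λ t → Σ< t f) (sym (cong suc (ℕP.m+[n∸m]≡n n≤m))))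
                          (Σ<-vanishing-tail (suc n) (m ∸ n) f vanish)

  G-extended : ∀ k → G n k ≡ Σ< M (λ l → ρ n l * recip (gap l k))
  G-extended k = sym (extend (λ l → ρ n l * recip (gap l k))
    (λ l n<l → trans (cong (_* recip (gap l k)) (ρ-vanishes n l n<l)) (*-zeroˡ (recip (gap l k)))))

  Σρn≡1 : Σ< M (ρ n) ≡ 1ℚ
  Σρn≡1 = trans (extend (ρ n) (ρ-vanishes n)) (Invariant.Σρ≡1 (invariant n))

  cross-left : Σ< M (λ k → ι k * (ρ m k * G n k)) ≡ Σ< M (λ k → Σ< M (λ l → ρ m k * ρ n l * (ι k * recip (gap l k))))
  cross-left = Σ<-cong M (λ k _ → begin
      ι k * (ρ m k * G n k)
        ≡⟨ cong (λ t → ι k * (ρ m k * t)) (G-extended k) ⟩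
      ι k * (ρ m k * Σ< M (λ l → ρ n l * recip (gap l k)))
        ≡⟨ trans (sym (*-assoc (ι k) (ρ m k) _)) (sym (Σ<-*ˡ M (ι k * ρ m k) (λ l → ρ n l * recip (gap l k)))) ⟩
      Σ< M (λ l → ι k * ρ m k * (ρ n l * recip (gap l k)))
        ≡⟨ Σ<-cong M (λ l _ → solve 4 (λ K U V r → K :* U :* (V :* r) := U :* V :* (K :* r)) refl (ι k) (ρ m k) (ρ n l) (recip (gap l k))) ⟩
      Σ< M (λ l → ρ m k * ρ n l * (ι k * recip (gap l k))) ∎)

  cross-right : Σ< M (λ k → ι k * (ρ n k * G m k)) ≡ Σ< M (λ k → Σ< M (λ l → ρ m k * ρ n l * (ι l * recip (gap k l))))
  cross-right = trans (Σ<-cong M (λ k _ → begin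
      ι k * (ρ n k * G m k)
        ≡⟨ trans (sym (*-assoc (ι k) (ρ n k) _)) (sym (Σ<-*ˡ M (ι k * ρ n k) (λ l → ρ m l * recip (gap l k)))) ⟩
      Σ< M (λ l → ι k * ρ n k * (ρ m l * recip (gap l k)))
        ≡⟨ Σ<-cong M (λ l _ → solve 4 (λ K U V r → K :* U :* (V :* r) := V :* U :* (K :* r)) refl (ι k) (ρ n k) (ρ m l) (recip (gap l k))) ⟩
      Σ< M (λ l → ρ m l * ρ n k * (ι k * recip (gap l k))) ∎))
    (Σ<-swap M M (λ k l → ρ m l * ρ n k * (ι k * recip (gap l k))))

  kernel-sum : Σ< M (λ k → Σ< M (λ l → ρ m k * ρ n l * (δ l k - 1ℚ))) ≡ Σ< M (λ k → ρ m k * ρ n k) - 1ℚ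
  kernel-sum = begin
      Σ< M (λ k → Σ< M (λ l → ρ m k * ρ n l * (δ l k - 1ℚ)))
        ≡⟨ Σ<-cong M inner ⟩
      Σ< M (λ k → ρ m k * ρ n k + (- 1ℚ) * ρ m k)
        ≡⟨ trans (Σ<-+ M _ _) (cong (Σ< M (λ k → ρ m k * ρ n k) +_) (Σ<-*ˡ M (- 1ℚ) (ρ m))) ⟩
      Σ< M (λ k → ρ m k * ρ n k) + (- 1ℚ) * Σ< M (ρ m)
        ≡⟨ cong (λ t → Σ< M (λ k → ρ m k * ρ n k) + (- 1ℚ) * t) (Invariant.Σρ≡1 (invariant m)) ⟩
      Σ< M (λ k → ρ m k * ρ n k) - 1ℚ ∎
    where
    inner : ∀ k → k ℕ.< M → Σ< M (λ l → ρ m k * ρ n l * (δ l k - 1ℚ)) ≡ ρ m k * ρ n k + (- 1ℚ) * ρ m k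
    inner k k<M = begin
        Σ< M (λ l → ρ m k * ρ n l * (δ l k - 1ℚ))
          ≡⟨ Σ<-cong M (λ l _ → solve 3 (λ U V d → U :* V :* (d :- con 1ℚ) := U :* (V :* d) :+ (:- U) :* V) refl (ρ m k) (ρ n l) (δ l k)) ⟩
        Σ< M (λ l → ρ m k * (ρ n l * δ l k) + (- ρ m k) * ρ n l)
          ≡⟨ Σ<-linear₂ M (ρ m k) (- ρ m k) (λ l → ρ n l * δ l k) (ρ n) ⟩
        ρ m k * Σ< M (λ l → ρ n l * δ l k) + (- ρ m k) * Σ< M (ρ n)
          ≡⟨ cong₂ (λ x y → ρ m k * x + (- ρ m k) * y) (Σ<-δ M (ρ n) k k<M) Σρn≡1 ⟩
        ρ m k * ρ n k + (- ρ m k) * 1ℚ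
          ≡⟨ cong (ρ m k * ρ n k +_) (solve 1 (λ U → (:- U) :* con 1ℚ := (:- con 1ℚ) :* U) refl (ρ m k)) ⟩
        ρ m k * ρ n k + (- 1ℚ) * ρ m k ∎

  cross-sum : Σ< M (λ k → ι k * (ρ m k * G n k) + ι k * (ρ n k * G m k)) ≡ Σ< M (λ k → ρ m k * ρ n k) - 1ℚ
  cross-sum = begin
      Σ< M (λ k → ι k * (ρ m k * G n k) + ι k * (ρ n k * G m k))
        ≡⟨ trans (Σ<-+ M _ _) (cong₂ _+_ cross-left cross-right) ⟩
      Σ< M (λ k → Σ< M (λ l → ρ m k * ρ n l * (ι k * recip (gap l k))))
        + Σ< M (λ k → Σ< M (λ l → ρ m k * ρ n l * (ι l * recip (gap k l))))
        ≡⟨ sym (Σ<-+ M _ _) ⟩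
      Σ< M (λ k → Σ< M (λ l → ρ m k * ρ n l * (ι k * recip (gap l k)))
                 + Σ< M (λ l → ρ m k * ρ n l * (ι l * recip (gap k l))))
        ≡⟨ Σ<-cong M (λ k _ → trans (sym (Σ<-+ M _ _)) (Σ<-cong M (λ l _ →
             trans (sym (*-distribˡ-+ (ρ m k * ρ n l) _ _)) (cong (ρ m k * ρ n l *_) (symmetric-kernel k l))))) ⟩
      Σ< M (λ k → Σ< M (λ l → ρ m k * ρ n l * (δ l k - 1ℚ)))
        ≡⟨ kernel-sum ⟩
      Σ< M (λ k → ρ m k * ρ n k) - 1ℚ ∎

  ΣX≡1 : Σ< M X ≡ 1ℚ
  ΣX≡1 = begin
      Σ< M X
        ≡⟨ Σ<-cong M (λ k _ → cong (λ t → ρ m k * ρ n k - t) (*-distribˡ-+ (ι k) (ρ m k * G n k) (ρ n k * G m k))) ⟩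
      Σ< M (λ k → ρ m k * ρ n k - (ι k * (ρ m k * G n k) + ι k * (ρ n k * G m k)))
        ≡⟨ Σ<-sub M _ _ ⟩
      Σ< M (λ k → ρ m k * ρ n k) - Σ< M (λ k → ι k * (ρ m k * G n k) + ι k * (ρ n k * G m k))
        ≡⟨ cong (λ t → Σ< M (λ k → ρ m k * ρ n k) - t) cross-sum ⟩
      Σ< M (λ k → ρ m k * ρ n k) - (Σ< M (λ k → ρ m k * ρ n k) - 1ℚ)
        ≡⟨ solve 1 (λ x → x :- (x :- con 1ℚ) := con 1ℚ) refl (Σ< M (λ k → ρ m k * ρ n k)) ⟩
      1ℚ ∎

H≡Hℚ : ∀ n → H 1 n ≡ Hℚ n
H≡Hℚ zero    = refl
H≡Hℚ (suc n) = cong₂ _+_ (H≡Hℚ n)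
  (trans (inv≡recip (suc (n ℕ.* 1)) (ℕ.s≤s ℕ.z≤n)) (cong (λ t → recip (ι (suc t))) (ℕP.*-identityʳ n)))

-- For k ≤ n: with ρ_m(k) = s₁c₁c₂, ρ_n(k) = s₂c₃c₄ and G_N(k) = -ρ_N(k)·hIn N k,
--   c₁c₂c₃c₄(1 + k(h₁+h₂+h₃+h₄ - 4H_k)) = σ·X_k   whenever σ·s₁s₂ = 1.
lower-term-algebra : ∀ σ s₁ s₂ c₁ c₂ c₃ c₄ k h₁ h₂ h₃ h₄ Hk four → σ * (s₁ * s₂) ≡ 1ℚ → four ≡ (1ℚ + 1ℚ) + (1ℚ + 1ℚ) →
  c₁ * c₂ * c₃ * c₄ * (1ℚ + k * (h₁ + h₂ + h₃ + h₄ - four * Hk))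
    ≡ σ * ((s₁ * c₁ * c₂) * (s₂ * c₃ * c₄)
           - k * ((s₁ * c₁ * c₂) * (- ((s₂ * c₃ * c₄) * (h₃ + h₄ - (1ℚ + 1ℚ) * Hk)))
                  + (s₂ * c₃ * c₄) * (- ((s₁ * c₁ * c₂) * (h₁ + h₂ - (1ℚ + 1ℚ) * Hk)))))
lower-term-algebra σ s₁ s₂ c₁ c₂ c₃ c₄ k h₁ h₂ h₃ h₄ Hk four signs refl = begin
    W
      ≡⟨ sym (*-identityˡ W) ⟩
    1ℚ * W
      ≡⟨ cong (_* W) (sym signs) ⟩
    σ * (s₁ * s₂) * W
      ≡⟨ solve 14 (λ σ s₁ s₂ c₁ c₂ c₃ c₄ k h₁ h₂ h₃ h₄ Hk W →
            σ :* (s₁ :* s₂) :* (c₁ :* c₂ :* c₃ :* c₄ :* (con 1ℚ :+ k :* (h₁ :+ h₂ :+ h₃ :+ h₄ :- ((con 1ℚ :+ con 1ℚ) :+ (con 1ℚ :+ con 1ℚ)) :* Hk))) :=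
            σ :* ((s₁ :* c₁ :* c₂) :* (s₂ :* c₃ :* c₄)
                  :- k :* ((s₁ :* c₁ :* c₂) :* (:- ((s₂ :* c₃ :* c₄) :* (h₃ :+ h₄ :- (con 1ℚ :+ con 1ℚ) :* Hk)))
                           :+ (s₂ :* c₃ :* c₄) :* (:- ((s₁ :* c₁ :* c₂) :* (h₁ :+ h₂ :- (con 1ℚ :+ con 1ℚ) :* Hk))))))
            refl σ s₁ s₂ c₁ c₂ c₃ c₄ k h₁ h₂ h₃ h₄ Hk W ⟩
    _ ∎
  where
  open ≡-Reasoning
  W = c₁ * c₂ * c₃ * c₄ * (1ℚ + k * (h₁ + h₂ + h₃ + h₄ - ((1ℚ + 1ℚ) + (1ℚ + 1ℚ)) * Hk))

-- For n < k ≤ m: ρ_n(k) = 0, and k·C(k-1,n)·G_n(k) = -C(n+k,k) turns σ·X_k into the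
-- summand s·c₁c₂c₃/C(k-1,n), where ρ_m(k) = s′c₁c₂ and σs′ = s.
upper-term-algebra : ∀ σ s′ s c₁ c₂ c₃ D k g g′ r → σ * s′ ≡ s → k * D * g ≡ - c₃ → D * r ≡ 1ℚ →
  s * c₁ * c₂ * c₃ * r ≡ σ * ((s′ * c₁ * c₂) * 0ℚ - k * ((s′ * c₁ * c₂) * g + 0ℚ * g′))
upper-term-algebra σ s′ s c₁ c₂ c₃ D k g g′ r signs previous r-inv = sym (begin
    σ * ((s′ * c₁ * c₂) * 0ℚ - k * ((s′ * c₁ * c₂) * g + 0ℚ * g′))
      ≡⟨ solve 7 (λ σ s′ c₁ c₂ k g g′ → σ :* ((s′ :* c₁ :* c₂) :* con 0ℚ :- k :* ((s′ :* c₁ :* c₂) :* g :+ con 0ℚ :* g′)) :=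
            (σ :* s′) :* c₁ :* c₂ :* (:- (k :* g))) refl σ s′ c₁ c₂ k g g′ ⟩
    (σ * s′) * c₁ * c₂ * (- (k * g))
      ≡⟨ cong₂ (λ x y → x * c₁ * c₂ * (- y)) signs k*g ⟩
    s * c₁ * c₂ * (- ((- c₃) * r))
      ≡⟨ solve 5 (λ s c₁ c₂ c₃ r → s :* c₁ :* c₂ :* (:- ((:- c₃) :* r)) := s :* c₁ :* c₂ :* c₃ :* r) refl s c₁ c₂ c₃ r ⟩
    s * c₁ * c₂ * c₃ * r ∎)
  where
  open ≡-Reasoning
  k*g : k * g ≡ (- c₃) * r
  k*g = begin
      k * g            ≡⟨ sym (trans (cong (k * g *_) r-inv) (*-identityʳ (k * g))) ⟩
      k * g * (D * r)  ≡⟨ solve 4 (λ k g D r → k :* g :* (D :* r) := k :* D :* g :* r) refl k g D r ⟩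
      k * D * g * r    ≡⟨ cong (_* r) previous ⟩
      (- c₃) * r       ∎

module Summands (m n : ℕ) (n≤m : n ℕ.≤ m) where
  open DoubleSum m n n≤m using (X)
  open ≡-Reasoning

  B≡Cℚ : ∀ x y → B x y ≡ Cℚ x y
  B≡Cℚ x y = sym (ι-def (x C y))

  lower-summand-cong : ∀ {c₁ c₁′ c₂ c₂′ c₃ c₃′ c₄ c₄′ k k′ h₁ h₁′ h₂ h₂′ h₃ h₃′ h₄ h₄′ f f′ h h′} →
    c₁ ≡ c₁′ → c₂ ≡ c₂′ → c₃ ≡ c₃′ → c₄ ≡ c₄′ → k ≡ k′ → h₁ ≡ h₁′ → h₂ ≡ h₂′ → h₃ ≡ h₃′ → h₄ ≡ h₄′ → f ≡ f′ → h ≡ h′ →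
    c₁ * c₂ * c₃ * c₄ * (1ℚ + k * (h₁ + h₂ + h₃ + h₄ - f * h))
      ≡ c₁′ * c₂′ * c₃′ * c₄′ * (1ℚ + k′ * (h₁′ + h₂′ + h₃′ + h₄′ - f′ * h′))
  lower-summand-cong refl refl refl refl refl refl refl refl refl refl refl = refl

  lower-term : ∀ k → k ℕ.≤ n →
    B (m ℕ.+ k) k * B m k * B (n ℕ.+ k) k * B n k
        * (1ℚ + ⟦ k ⟧ * (H 1 (m ℕ.+ k) + H 1 (m ∸ k) + H 1 (n ℕ.+ k) + H 1 (n ∸ k) - ⟦ 4 ⟧ * H 1 k))
    ≡ sign (m ℕ.+ n) * X k
  lower-term k k≤n = begin
      B (m ℕ.+ k) k * B m k * B (n ℕ.+ k) k * B n k
        * (1ℚ + ⟦ k ⟧ * (H 1 (m ℕ.+ k) + H 1 (m ∸ k) + H 1 (n ℕ.+ k) + H 1 (n ∸ k) - ⟦ 4 ⟧ * H 1 k))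
        ≡⟨ lower-summand-cong (B≡Cℚ (m ℕ.+ k) k) (B≡Cℚ m k) (B≡Cℚ (n ℕ.+ k) k) (B≡Cℚ n k) (sym (ι-def k))
             (H≡Hℚ (m ℕ.+ k)) (H≡Hℚ (m ∸ k)) (H≡Hℚ (n ℕ.+ k)) (H≡Hℚ (n ∸ k)) (sym (ι-def 4)) (H≡Hℚ k) ⟩
      Cℚ (m ℕ.+ k) k * Cℚ m k * Cℚ (n ℕ.+ k) k * Cℚ n k
        * (1ℚ + ι k * (Hℚ (m ℕ.+ k) + Hℚ (m ∸ k) + Hℚ (n ℕ.+ k) + Hℚ (n ∸ k) - ι 4 * Hℚ k))
        ≡⟨ lower-term-algebra (sign (m ℕ.+ n)) (sign (m ℕ.+ k)) (sign (n ℕ.+ k))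
             (Cℚ (m ℕ.+ k) k) (Cℚ m k) (Cℚ (n ℕ.+ k) k) (Cℚ n k) (ι k)
             (Hℚ (m ℕ.+ k)) (Hℚ (m ∸ k)) (Hℚ (n ℕ.+ k)) (Hℚ (n ∸ k)) (Hℚ k) (ι 4) (sign-cancel m n k) (ι-def 4) ⟩
      sign (m ℕ.+ n) * (ρ m k * ρ n k - ι k * (ρ m k * (- (ρ n k * hIn n k)) + ρ n k * (- (ρ m k * hIn m k))))
        ≡⟨ cong₂ (λ x y → sign (m ℕ.+ n) * (ρ m k * ρ n k - ι k * (ρ m k * x + ρ n k * y)))
             (sym (Invariant.G-inside (invariant n) k k≤n)) (sym (Invariant.G-inside (invariant m) k (ℕP.≤-trans k≤n n≤m))) ⟩
      sign (m ℕ.+ n) * X k ∎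

  upper-summand-cong : ∀ s {c₁ c₁′ c₂ c₂′ c₃ c₃′ i i′} → c₁ ≡ c₁′ → c₂ ≡ c₂′ → c₃ ≡ c₃′ → i ≡ i′ →
    s * c₁ * c₂ * c₃ * i ≡ s * c₁′ * c₂′ * c₃′ * i′
  upper-summand-cong s refl refl refl refl = refl

  upper-term : ∀ k → n ℕ.< k → k ℕ.≤ m →
    sign (k ∸ n) * B (m ℕ.+ k) k * B m k * B (n ℕ.+ k) k * inv ((k ∸ 1) C n) ≡ sign (m ℕ.+ n) * X k
  upper-term k n<k k≤m = begin
      sign (k ∸ n) * B (m ℕ.+ k) k * B m k * B (n ℕ.+ k) k * inv ((k ∸ 1) C n)
        ≡⟨ upper-summand-cong (sign (k ∸ n)) (B≡Cℚ (m ℕ.+ k) k) (B≡Cℚ m k) (B≡Cℚ (n ℕ.+ k) k) (inv≡recip ((k ∸ 1) C n) C-pos) ⟩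
      sign (k ∸ n) * Cℚ (m ℕ.+ k) k * Cℚ m k * Cℚ (n ℕ.+ k) k * recip (Cℚ (k ∸ 1) n)
        ≡⟨ upper-term-algebra (sign (m ℕ.+ n)) (sign (m ℕ.+ k)) (sign (k ∸ n)) (Cℚ (m ℕ.+ k) k) (Cℚ m k) (Cℚ (n ℕ.+ k) k)
             (Cℚ (k ∸ 1) n) (ι k) (G n k) (G m k) (recip (Cℚ (k ∸ 1) n))
             (sign-shift m n k (ℕP.<⇒≤ n<k)) (Invariant.G-outside (invariant n) k n<k) (ι-recip-inverse ((k ∸ 1) C n) C-pos) ⟩
      sign (m ℕ.+ n) * (ρ m k * 0ℚ - ι k * (ρ m k * G n k + 0ℚ * G m k))
        ≡⟨ cong (λ t → sign (m ℕ.+ n) * (ρ m k * t - ι k * (ρ m k * G n k + t * G m k))) (sym (ρ-vanishes n k n<k)) ⟩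
      sign (m ℕ.+ n) * X k ∎
    where
    C-pos : 0 ℕ.< (k ∸ 1) C n
    C-pos = C-positive (k ∸ 1) n (ℕP.∸-monoˡ-≤ 1 n<k)

-- The theorem: split the range k ≤ m at n, match the summands with (-1)^{m+n}·X_k, and use
-- Σ X_k = 1.
theorem1p2 : (m n : ℕ) → n ≥ 1 → m ≥ n →
    sumFromTo 0 n (λ k → B (m ℕ.+ k) k * B m k * B (n ℕ.+ k) k * B n k
    * (1ℚ + ⟦ k ⟧ * (H 1 (m ℕ.+ k) + H 1 (m ∸ k) + H 1 (n ℕ.+ k) + H 1 (n ∸ k) - ⟦ 4 ⟧ * H 1 k)))
    + sumFromTo (ℕ.suc n) m (λ k → sign (k ∸ n) * B (m ℕ.+ k) k * B m k * B (n ℕ.+ k) k * inv ((k ∸ 1) C n))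
    ≡ sign (m ℕ.+ n)
theorem1p2 m n _ n≤m = begin
    sumFromTo 0 n lower + sumFromTo (suc n) m upper
      ≡⟨ cong₂ _+_ (sumFromTo-0≡Σ< n lower) (sumFromTo≡Σfrom (suc n) m upper (m ∸ n) refl) ⟩
    Σ< (suc n) lower + Σfrom (suc n) (m ∸ n) upper
      ≡⟨ cong₂ _+_ (Σ<-cong (suc n) (λ k k≤n → lower-term k (ℕP.≤-pred k≤n)))
                   (Σfrom-cong (suc n) (m ∸ n) (λ j j<m-n → upper-term (suc n ℕ.+ j) (ℕ.s≤s (ℕP.m≤m+n n j))
                      (ℕP.≤-trans (ℕP.+-monoʳ-< n j<m-n) (ℕP.≤-reflexive (ℕP.m+[n∸m]≡n n≤m))))) ⟩
    Σ< (suc n) Y + Σfrom (suc n) (m ∸ n) Y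
      ≡⟨ sym (Σ<-split (suc n) (m ∸ n) Y) ⟩
    Σ< (suc n ℕ.+ (m ∸ n)) Y
      ≡⟨ cong (λ t → Σ< (suc t) Y) (ℕP.m+[n∸m]≡n n≤m) ⟩
    Σ< (suc m) Y
      ≡⟨ Σ<-*ˡ (suc m) (sign (m ℕ.+ n)) X ⟩
    sign (m ℕ.+ n) * Σ< (suc m) X
      ≡⟨ trans (cong (sign (m ℕ.+ n) *_) ΣX≡1) (*-identityʳ (sign (m ℕ.+ n))) ⟩
    sign (m ℕ.+ n) ∎
  where
  open ≡-Reasoning
  open DoubleSum m n n≤m using (X; ΣX≡1)
  open Summands m n n≤m using (lower-term; upper-term)
  lower upper Y : ℕ → ℚ
  lower k = B (m ℕ.+ k) k * B m k * B (n ℕ.+ k) k * B n k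
    * (1ℚ + ⟦ k ⟧ * (H 1 (m ℕ.+ k) + H 1 (m ∸ k) + H 1 (n ℕ.+ k) + H 1 (n ∸ k) - ⟦ 4 ⟧ * H 1 k))
  upper k = sign (k ∸ n) * B (m ℕ.+ k) k * B m k * B (n ℕ.+ k) k * inv ((k ∸ 1) C n)
  Y k = sign (m ℕ.+ n) * X k
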